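{- Let $n,r\in\mathbb{N}_0$, let $\mathbf{Y}=(Y_0,Y_1,\dots,Y_n)$ be variables, and fix any linear order on $P_{n,r}$. Let $Z=(z_{a,b})$ and $M=(m_{a,b})$ be the $(r+1)2^n\times(r+1)2^n$ matrices, with rows and columns indexed by $P_{n,r}$ in that order, given by \[ z_{a,b}=w_{a,b}(\mathbf{Y}),\qquad m_{a,b}=(-1)^{\Delta_{n+1}(a,b)}\prod_{i=0}^{n}Y_i^{\Delta_i(a,b)}\cdot w_{a,b}(\mathbf{Y}^{ -1}) \] for all $a,b\in P_{n,r}$. Then $M$ is the inverse of $Z$.
   Context: $\mathbb{N}_0$ is the set of non-negative integers. For a variable $Y$ and integers $0\le k\le n$, $\binom{n}{k}_Y=\prod_{i=1}^{k}\frac{1-Y^{n-k+i}}{1-Y^i}$; set it to $0$ if $k>n$. $P_{n,r}$ is the set of tuples $a=(a_0,\dots,a_n)$ of non-negative integers with $a_0\le r$ and $a_i\le1$ for $1\le i\le n$, partially ordered by $a\le_t b$ iff $\sum_{j=0}^i a_j\le\sum_{j=0}^i b_j$ for all $0\le i\le n$. Set $s_0(a)=\binom{a_0}{2}$, $s_i(a)=\sum_{k=0}^{i-1}a_k$ for $1\le i\le n+1$, and $\Delta_i(a,b)=s_i(b)-s_i(a)$ for $0\le i\le n+1$. Define $w_{a,b}(\mathbf{Y})=\theta_{a,b}(Y_0)\phi_{a,b}(Y_1,\dots,Y_n)$ where $\theta_{a,b}(Y_0)=\binom{b_0}{a_0}_{Y_0}$ and $\phi_{a,b}=\prod_{i\in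 L_{a,b}}(1-Y_i^{\Delta_i(a,b)})$ if $a\le_t b$, $\phi_{a,b}=0$ otherwise, with $L_{a,b}=\{i\in\{1,\dots,n\}:a_i=1,b_i=0\}$. $w_{a,b}(\mathbf{Y}^{ -1})$ denotes substitution of $Y_i^{ -1}$ for each $Y_i$; the matrices have entries in $\mathbb{Z}[Y_0^{\pm1},\dots,Y_n^{\pm1}]$. -}

module Defs where

open import Level using (Level)
open import Data.Bool using (Bool; true; false; if_then_else_; _∧_)
open import Data.Nat as ℕ using (ℕ; zero; suc; _∸_; _≤ᵇ_)
open import Data.Nat.Combinatorics using (_C_)
open import Data.Integer as ℤ using (ℤ; +_; -[1+_]; ∣_∣)
open import Data.Fin using (Fin; zero; suc; toℕ)
open import Data.Fin.Properties as FinP using ()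
open import Data.Vec using (Vec; []; _∷_; lookup)
open import Data.Vec.Properties as VecP using ()
open import Data.Bool.Properties as BoolP using ()
open import Data.Product using (_×_; _,_; proj₁; proj₂)
open import Data.Product.Properties using (≡-dec)
open import Data.List using (List; []; _∷_; upTo; map)
open import Data.Bool.ListAction using (and)
open import Relation.Nullary using (does)
open import Relation.Binary.PropositionalEquality using (_≡_)
open import Relation.Binary.Definitions using (DecidableEquality)
open import Algebra.Bundles using (CommutativeRing)

-- The poset P_{n,r}
-- An element a = (a_0, a_1, ..., a_n) with a_0 ≤ r and a_i ∈ {0,1}
-- is represented as (a_0 , (a_1 ∷ ... ∷ a_n)) with a_0 : Fin (suc r)
-- and a_i : Bool (true = 1, false = 0).

P : ℕ → ℕ → Set
P n r = Fin (suc r) × Vec Bool n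

_≟P_ : ∀ {n r} → DecidableEquality (P n r)
_≟P_ = ≡-dec FinP._≟_ (VecP.≡-dec BoolP._≟_)

b2n : Bool → ℕ
b2n true  = 1
b2n false = 0

bitsum : ∀ {n} → ℕ → Vec Bool n → ℕ
bitsum zero    _        = 0
bitsum (suc k) []       = 0
bitsum (suc k) (x ∷ xs) = b2n x ℕ.+ bitsum k xs

a₀ : ∀ {n r} → P n r → ℕ
a₀ a = toℕ (proj₁ a)

-- pre a k = a_0 + a_1 + ... + a_k   (0 ≤ k ≤ n)
-- hence s_i(a) = pre a (i - 1) for 1 ≤ i ≤ n + 1.
pre : ∀ {n r} → P n r → ℕ → ℕ
pre a k = a₀ a ℕ.+ bitsum k (proj₂ a)

leqt : ∀ {n r} → P n r → P n r → Bool
leqt {n} a b = and (map (λ i → pre a i ≤ᵇ pre b i) (upTo (suc n)))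

s₀ : ∀ {n r} → P n r → ℕ
s₀ a = a₀ a C 2

sᵢ : ∀ {n r} → P n r → Fin (suc (suc n)) → ℕ
sᵢ a zero    = s₀ a
sᵢ a (suc j) = pre a (toℕ j)      -- s_{j+1}(a) = a_0 + ... + a_j

Δ : ∀ {n r} → Fin (suc (suc n)) → P n r → P n r → ℤ
Δ i a b = (+ sᵢ b i) ℤ.- (+ sᵢ a i)

module Mat {c ℓ : Level} (R : CommutativeRing c ℓ) where
  open CommutativeRing R hiding (zero)

  pow : Carrier → ℕ → Carrier
  pow x zero    = 1#
  pow x (suc k) = x * pow x k

  -- integer power of a unit x with chosen inverse xi
  ipow : Carrier → Carrier → ℤ → Carrier
  ipow x xi (+ k)     = pow x k
  ipow x xi -[1+ k ]  = pow xi (suc k)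

  sgn : ℤ → Carrier
  sgn z = pow (- 1#) ∣ z ∣

  prodF : ∀ {m} → (Fin m → Carrier) → Carrier
  prodF {zero}  f = 1#
  prodF {suc m} f = f zero * prodF (λ j → f (suc j))

  sumL : ∀ {A : Set} → List A → (A → Carrier) → Carrier
  sumL []       f = 0#
  sumL (x ∷ xs) f = f x + sumL xs f

  gbinom : Carrier → ℕ → ℕ → Carrier
  gbinom q m       zero    = 1#
  gbinom q zero    (suc k) = 0#
  gbinom q (suc m) (suc k) = gbinom q m k + pow q (suc k) * gbinom q m (suc k)

  -- Y i for i = 0..n ; Y (suc j) is Y_{j+1}
  module _ {n r : ℕ} (Y : Fin (suc n) → Carrier) where

    θ : P n r → P n r → Carrier
    θ a b = gbinom (Y zero) (a₀ b) (a₀ a)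

    -- factor for index i = j+1 : (1 - Y_i^{Δ_i}) if i ∈ L_{a,b}, else 1
    -- (Δ_i(a,b) = pre b j - pre a j ≥ 0 whenever a ≤_t b)
    φfactor : P n r → P n r → Fin n → Carrier
    φfactor a b j with lookup (proj₂ a) j | lookup (proj₂ b) j
    ... | true | false = 1# - pow (Y (suc j)) (pre b (toℕ j) ∸ pre a (toℕ j))
    ... | _    | _     = 1#

    φ : P n r → P n r → Carrier
    φ a b = if leqt a b then prodF (φfactor a b) else 0#

    w : P n r → P n r → Carrier
    w a b = θ a b * φ a b

  module _ {n r : ℕ} (Y Yinv : Fin (suc n) → Carrier) where

    Zm : P n r → P n r → Carrier
    Zm a b = w Y a b

    Mm : P n r → P n r → Carrier
    Mm a b = sgn (Δ (Data.Fin.fromℕ (suc n)) a b)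
             * prodF (λ (i : Fin (suc n)) → ipow (Y i) (Yinv i) (Δ (Data.Fin.inject₁ i) a b))
             * w Yinv a b

    δ : P n r → P n r → Carrier
    δ a b = if does (a ≟P b) then 1# else 0#

    _·[_]_ : (P n r → P n r → Carrier) → List (P n r) → (P n r → P n r → Carrier)
               → P n r → P n r → Carrier
    (A ·[ enum ] B) a c = sumL enum (λ b → A a b * B b c)

{-# OPTIONS --safe #-}
module Submission where

-- Both matrices split into a part indexed by a₀, made of Gaussian binomials in Y₀, and a bit part
-- which, once the prefix sums s_i are carried along as offsets, is a product of local weights over
-- the positions 1 … n.  In Z M the sum over the middle index b is taken position by position: at
-- each position the local weights of z and m compose to a weight η of (a_i, c_i, Δ_i(a,c)) alone, so
-- b enters only through the guard a ≤_t b ≤_t c, and where that fails the local factor 1 - Y⁰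
-- vanishes.  The η-part is the identity at equal offsets, and the a₀-part is q-binomial inversion
--   Σ_b [b a] (-1)^(c-b) q^C(c-b,2) [c b] = δ_ac,
-- which follows from [c b] [b a] = [c a] [c-a b-a] and Σ_j [N j] (-1)^(N-j) q^C(N-j,2) = 0 for N > 0.
--
-- M Z = I needs no second computation: with f(a) = (-1)^s_{n+1}(a) ∏ Y_i^s_i(a) one has
-- m_ab = f(b) / f(a) · w_ab(Y⁻¹), that is M(Y) = D⁻¹ Z(Y⁻¹) D for D = diag f, and D(Y⁻¹) = D(Y)⁻¹,
-- so M(Y) Z(Y) = D⁻¹ Z(Y⁻¹) M(Y⁻¹) D = I by the first half with Y and Y⁻¹ exchanged.

open import Algebra.Bundles using (CommutativeRing)
open import Algebra.Solver.Ring.AlmostCommutativeRing using (fromCommutativeRing; _-Raw-AlmostCommutative⟶_)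
import Algebra.Properties.CommutativeSemigroup as CommutativeSemigroupProperties
import Algebra.Properties.Ring as RingProperties
import Algebra.Properties.Semiring.Mult.TCOptimised as Multiples
import Algebra.Properties.Semiring.Sum as SemiringSum
import Algebra.Solver.Ring
open import Data.Bool using (Bool; true; false; if_then_else_; _∧_)
import Data.Bool.Properties as Bool
open import Data.Bool.ListAction using (and)
open import Data.Fin as Fin using (Fin; zero; suc; toℕ)
import Data.Fin.Properties as Fin
open import Data.Integer as ℤ using (ℤ; +_; -[1+_]; _⊖_)
import Data.Integer.Properties as ℤ
open import Data.List using (List; []; _∷_; map; upTo; applyUpTo)
import Data.List.Properties as List
open import Data.List.Membership.Propositional using (_∈_)
import Data.List.Relation.Unary.All as All
open import Data.List.Relation.Unary.AllPairs using (_∷_)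
open import Data.List.Relation.Unary.Any using (here; there)
open import Data.List.Relation.Unary.Unique.Propositional using (Unique)
open import Data.Maybe using (Maybe; just; nothing)
open import Data.Nat as ℕ using (ℕ; zero; suc; _≤_; _<_; _∸_; _≤ᵇ_; z≤n; s≤s)
import Data.Nat.Properties as ℕ
open import Data.Nat.Combinatorics using (_C_; nC1≡n; nCk+nC[k+1]≡[n+1]C[k+1])
open import Data.Product using (_×_; _,_; proj₁; proj₂)
import Data.Sign as Sign
open import Data.Sum using (_⊎_; inj₁; inj₂)
open import Data.Vec using (Vec; []; _∷_; lookup)
import Data.Vec.Properties as Vec
open import Function using (_∘_)
open import Function.Bundles using (Equivalence)
open import Level using (Level)
open import Relation.Binary.Definitions using (tri<; tri≈; tri>)
open import Relation.Binary.PropositionalEquality as ≡ using (_≡_; _≢_; ≢-sym)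
open import Relation.Nullary using (¬_; yes; no; does; contradiction)
open import Relation.Nullary.Reflects using (ofʸ)
open import Defs

C2-suc : ∀ d → suc d C 2 ≡ d ℕ.+ d C 2
C2-suc d = ≡.trans (≡.sym (nCk+nC[k+1]≡[n+1]C[k+1] d 1)) (≡.cong (ℕ._+ d C 2) (nC1≡n d))

C2-+ : ∀ b d → (b ℕ.+ d) C 2 ≡ b C 2 ℕ.+ (b ℕ.* d ℕ.+ d C 2)
C2-+ b zero    rewrite ℕ.+-identityʳ b | ℕ.*-zeroʳ b = ≡.sym (ℕ.+-identityʳ _)
C2-+ b (suc d) rewrite ℕ.+-suc b d | C2-suc (b ℕ.+ d) | C2-+ b d | C2-suc d | ℕ.*-suc b d = arithmetic (b C 2) b d (d C 2)
  where
  import Data.Nat.Tactic.RingSolver as NatSolver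
  arithmetic : ∀ x b d y → b ℕ.+ d ℕ.+ (x ℕ.+ (b ℕ.* d ℕ.+ y)) ≡ x ℕ.+ (b ℕ.+ b ℕ.* d ℕ.+ (d ℕ.+ y))
  arithmetic = NatSolver.solve-∀

≤ᵇ-true : ∀ {s t} → s ≤ t → (s ≤ᵇ t) ≡ true
≤ᵇ-true s≤t = Equivalence.to Bool.T-≡ (ℕ.≤⇒≤ᵇ s≤t)

≤ᵇ-false : ∀ {s t} → ¬ s ≤ t → (s ≤ᵇ t) ≡ false
≤ᵇ-false {s} {t} s≰t with s ≤ᵇ t | ℕ.≤ᵇ-reflects-≤ s t
... | false | _       = ≡.refl
... | true  | ofʸ s≤t = contradiction s≤t s≰t

step-≤ : ∀ {s t} → s ≤ t → ∀ x y → s ℕ.+ b2n x ≤ t ℕ.+ b2n y ⊎ (x ≡ true × y ≡ false × t ∸ s ≡ 0)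
step-≤ {s} {t} s≤t false y   = inj₁ (ℕ.≤-trans (ℕ.≤-reflexive (ℕ.+-identityʳ s)) (ℕ.≤-trans s≤t (ℕ.m≤m+n t (b2n y))))
step-≤         s≤t true true = inj₁ (ℕ.+-monoˡ-≤ 1 s≤t)
step-≤ {s} {t} s≤t true false with ℕ.m≤n⇒m<n∨m≡n s≤t
... | inj₁ s<t    = inj₁ (≡.subst₂ _≤_ (ℕ.+-comm 1 s) (≡.sym (ℕ.+-identityʳ t)) s<t)
... | inj₂ ≡.refl = inj₂ (≡.refl , ≡.refl , ℕ.n∸n≡0 s)

∸-+-∸ : ∀ {s t u} → s ≤ t → t ≤ u → (t ∸ s) ℕ.+ (u ∸ t) ≡ u ∸ s
∸-+-∸ {s} {t} {u} s≤t t≤u = begin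
  (t ∸ s) ℕ.+ (u ∸ t)      ≡⟨ ℕ.+-comm (t ∸ s) (u ∸ t) ⟩
  (u ∸ t) ℕ.+ (t ∸ s)      ≡⟨ ℕ.+-∸-assoc (u ∸ t) s≤t ⟨
  ((u ∸ t) ℕ.+ t) ∸ s      ≡⟨ ≡.cong (_∸ s) (ℕ.m∸n+n≡m t≤u) ⟩
  u ∸ s                    ∎
  where open ≡.≡-Reasoning

applyUpTo-cong : ∀ {A : Set} {f g : ℕ → A} n → (∀ i → f i ≡ g i) → applyUpTo f n ≡ applyUpTo g n
applyUpTo-cong zero    f≡g = ≡.refl
applyUpTo-cong (suc n) f≡g = ≡.cong₂ _∷_ (f≡g 0) (applyUpTo-cong n (f≡g ∘ suc))

-- leqt a b is prefixLeq (a₀ a) (proj₂ a) (a₀ b) (proj₂ b) by definition.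
prefixLeq : ∀ {m} → ℕ → Vec Bool m → ℕ → Vec Bool m → Bool
prefixLeq {m} s xs t ys = and (map (λ i → s ℕ.+ bitsum i xs ≤ᵇ t ℕ.+ bitsum i ys) (upTo (suc m)))

prefixLeq-[] : ∀ s t → prefixLeq s [] t [] ≡ (s ≤ᵇ t)
prefixLeq-[] s t rewrite ℕ.+-identityʳ s | ℕ.+-identityʳ t = Bool.∧-identityʳ (s ≤ᵇ t)

prefixLeq-∷ : ∀ {m} s x (xs : Vec Bool m) t y ys →
              prefixLeq s (x ∷ xs) t (y ∷ ys) ≡ (s ≤ᵇ t) ∧ prefixLeq (s ℕ.+ b2n x) xs (t ℕ.+ b2n y) ys
prefixLeq-∷ {m} s x xs t y ys = ≡.cong₂ (λ b bs → b ∧ and bs) (≡.cong₂ _≤ᵇ_ (ℕ.+-identityʳ s) (ℕ.+-identityʳ t)) (begin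
  map g (applyUpTo suc (suc m))   ≡⟨ List.map-applyUpTo suc g (suc m) ⟩
  applyUpTo (g ∘ suc) (suc m)     ≡⟨ applyUpTo-cong (suc m) shift ⟩
  applyUpTo g′ (suc m)            ≡⟨ List.map-applyUpTo (λ i → i) g′ (suc m) ⟨
  map g′ (upTo (suc m))           ∎)
  where
  open ≡.≡-Reasoning
  g : ℕ → Bool
  g i = s ℕ.+ bitsum i (x ∷ xs) ≤ᵇ t ℕ.+ bitsum i (y ∷ ys)
  g′ : ℕ → Bool
  g′ i = s ℕ.+ b2n x ℕ.+ bitsum i xs ≤ᵇ t ℕ.+ b2n y ℕ.+ bitsum i ys
  shift : ∀ i → g (suc i) ≡ g′ i
  shift i = ≡.cong₂ _≤ᵇ_ (≡.sym (ℕ.+-assoc s (b2n x) _)) (≡.sym (ℕ.+-assoc t (b2n y) _))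

Δ-split : ∀ {n r} i (a b c : P n r) → Δ i a b ≡ Δ i a c ℤ.+ ℤ.- Δ i b c
Δ-split i a b c = difference (+ sᵢ a i) (+ sᵢ b i) (+ sᵢ c i)
  where
  import Data.Integer.Tactic.RingSolver as IntegerSolver
  difference : ∀ x y z → y ℤ.- x ≡ (z ℤ.- x) ℤ.+ ℤ.- (z ℤ.- y)
  difference = IntegerSolver.solve-∀

Δ-refl : ∀ {n r} i (a : P n r) → Δ i a a ≡ + 0
Δ-refl i a = ℤ.+-inverseʳ (+ sᵢ a i)

-- Ring solver for R with integer coefficients, read in R through the canonical map ι : ℤ → R.
-- Unlike the solver whose coefficients are taken from R itself, it can cancel (x - x ≈ 0).
module IntegerCoefficients {c ℓ} (R : CommutativeRing c ℓ) where
  open CommutativeRing R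
  open RingProperties ring using (-‿involutive; -‿distribˡ-*; -‿distribʳ-*; -0#≈0#; -‿+-comm)
  open CommutativeSemigroupProperties +-commutativeSemigroup using (interchange)
  open Multiples semiring using (1+×; ×-homo-+; ×1-homo-*) renaming (_×_ to _×ₙ_)
  open import Relation.Binary.Reasoning.Setoid setoid

  ι : ℤ → Carrier
  ι (+ n)    = n ×ₙ 1#
  ι -[1+ n ] = - (suc n ×ₙ 1#)

  ι-⊖ : ∀ m n → ι (m ⊖ n) ≈ m ×ₙ 1# - n ×ₙ 1#
  ι-⊖ m zero = begin
    ι (m ⊖ 0)      ≡⟨ ≡.cong ι (ℤ.⊖-≥ {m} ℕ.z≤n) ⟩
    m ×ₙ 1#         ≈⟨ +-identityʳ _ ⟨
    m ×ₙ 1# + 0#    ≈⟨ +-congˡ -0#≈0# ⟨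
    m ×ₙ 1# - 0#    ∎
  ι-⊖ zero (suc n) = sym (+-identityˡ _)
  ι-⊖ (suc m) (suc n) = begin
    ι (suc m ⊖ suc n)                          ≡⟨ ≡.cong ι (ℤ.[1+m]⊖[1+n]≡m⊖n m n) ⟩
    ι (m ⊖ n)                                  ≈⟨ ι-⊖ m n ⟩
    m ×ₙ 1# - n ×ₙ 1#                            ≈⟨ +-identityˡ _ ⟨
    0# + (m ×ₙ 1# - n ×ₙ 1#)                     ≈⟨ +-congʳ (-‿inverseʳ 1#) ⟨
    (1# - 1#) + (m ×ₙ 1# - n ×ₙ 1#)              ≈⟨ interchange _ _ _ _ ⟩
    (1# + m ×ₙ 1#) + (- 1# - n ×ₙ 1#)            ≈⟨ +-congˡ (-‿+-comm 1# (n ×ₙ 1#)) ⟩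
    (1# + m ×ₙ 1#) - (1# + n ×ₙ 1#)              ≈⟨ +-cong (1+× m 1#) (-‿cong (1+× n 1#)) ⟨
    suc m ×ₙ 1# - suc n ×ₙ 1#                    ∎

  ι-+ : ∀ i j → ι (i ℤ.+ j) ≈ ι i + ι j
  ι-+ (+ m)    (+ n)    = ×-homo-+ 1# m n
  ι-+ (+ m)    -[1+ n ] = ι-⊖ m (suc n)
  ι-+ -[1+ m ] (+ n)    = trans (ι-⊖ n (suc m)) (+-comm _ _)
  ι-+ -[1+ m ] -[1+ n ] = begin
    - (suc (suc (m ℕ.+ n)) ×ₙ 1#)         ≡⟨ ≡.cong (λ k → - (suc k ×ₙ 1#)) (ℕ.+-suc m n) ⟨
    - ((suc m ℕ.+ suc n) ×ₙ 1#)           ≈⟨ -‿cong (×-homo-+ 1# (suc m) (suc n)) ⟩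
    - (suc m ×ₙ 1# + suc n ×ₙ 1#)          ≈⟨ -‿+-comm _ _ ⟨
    - (suc m ×ₙ 1#) + - (suc n ×ₙ 1#)      ∎

  ι-+◃ : ∀ n → ι (Sign.+ ℤ.◃ n) ≈ n ×ₙ 1#
  ι-+◃ zero    = refl
  ι-+◃ (suc n) = refl

  ι--◃ : ∀ n → ι (Sign.- ℤ.◃ n) ≈ - (n ×ₙ 1#)
  ι--◃ zero    = sym -0#≈0#
  ι--◃ (suc n) = refl

  ι-* : ∀ i j → ι (i ℤ.* j) ≈ ι i * ι j
  ι-* (+ m)    (+ n)    = trans (ι-+◃ (m ℕ.* n)) (×1-homo-* m n)
  ι-* (+ m)    -[1+ n ] = trans (ι--◃ (m ℕ.* suc n)) (trans (-‿cong (×1-homo-* m (suc n))) (-‿distribʳ-* _ _))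
  ι-* -[1+ m ] (+ n)    = trans (ι--◃ (suc m ℕ.* n)) (trans (-‿cong (×1-homo-* (suc m) n)) (-‿distribˡ-* _ _))
  ι-* -[1+ m ] -[1+ n ] = begin
    ι (Sign.+ ℤ.◃ suc m ℕ.* suc n)          ≈⟨ ι-+◃ (suc m ℕ.* suc n) ⟩
    (suc m ℕ.* suc n) ×ₙ 1#                  ≈⟨ ×1-homo-* (suc m) (suc n) ⟩
    x * y                                   ≈⟨ -‿involutive _ ⟨
    - - (x * y)                             ≈⟨ -‿cong (-‿distribʳ-* x y) ⟩
    - (x * - y)                             ≈⟨ -‿distribˡ-* x (- y) ⟩
    - x * - y                               ∎
    where
    x = suc m ×ₙ 1#
    y = suc n ×ₙ 1#

  ι-neg : ∀ i → ι (ℤ.- i) ≈ - ι i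
  ι-neg (+ zero)  = sym -0#≈0#
  ι-neg (+ suc n) = refl
  ι-neg -[1+ n ]  = sym (-‿involutive _)

  integerHomomorphism : ℤ.+-*-rawRing -Raw-AlmostCommutative⟶ fromCommutativeRing R
  integerHomomorphism = record
    { ⟦_⟧ = ι ; +-homo = ι-+ ; *-homo = ι-* ; -‿homo = ι-neg ; 0-homo = refl ; 1-homo = refl }

  ι-≟ : ∀ i j → Maybe (ι i ≈ ι j)
  ι-≟ i j with i ℤ.≟ j
  ... | yes ≡.refl = just refl
  ... | no _     = nothing

  open Algebra.Solver.Ring ℤ.+-*-rawRing (fromCommutativeRing R) integerHomomorphism ι-≟ public

  𝟘 𝟙 : ∀ {k} → Polynomial k
  𝟘 = con (+ 0)
  𝟙 = con (+ 1)

module _ {c ℓ} (R : CommutativeRing c ℓ) where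
  open CommutativeRing R hiding (zero)
  open Mat R hiding (δ)
  open IntegerCoefficients R using (Polynomial; solve; _:=_; _:+_; _:*_; _:-_; :-_; 𝟘; 𝟙)
  open CommutativeSemigroupProperties *-commutativeSemigroup using (interchange)
  open SemiringSum semiring using (sum; sum-syntax; sum-cong-≋; sum-replicate-zero; ∑-distrib-+; *-distribˡ-sum; *-distribʳ-sum)
  open import Relation.Binary.Reasoning.Setoid setoid

  pow-cong : ∀ {x y} n → x ≈ y → pow x n ≈ pow y n
  pow-cong zero    x≈y = refl
  pow-cong (suc n) x≈y = *-cong x≈y (pow-cong n x≈y)

  pow-+ : ∀ x m n → pow x (m ℕ.+ n) ≈ pow x m * pow x n
  pow-+ x zero    n = sym (*-identityˡ _)
  pow-+ x (suc m) n = trans (*-congˡ (pow-+ x m n)) (sym (*-assoc _ _ _))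

  pow-distrib-* : ∀ x y n → pow (x * y) n ≈ pow x n * pow y n
  pow-distrib-* x y zero    = sym (*-identityˡ 1#)
  pow-distrib-* x y (suc n) = trans (*-congˡ (pow-distrib-* x y n)) (interchange x y _ _)

  pow-1 : ∀ n → pow 1# n ≈ 1#
  pow-1 zero    = refl
  pow-1 (suc n) = trans (*-identityˡ _) (pow-1 n)

  pow-inverse : ∀ {u u⁻¹} → u * u⁻¹ ≈ 1# → ∀ n → pow u n * pow u⁻¹ n ≈ 1#
  pow-inverse {u} {u⁻¹} inv n = trans (sym (pow-distrib-* u u⁻¹ n)) (trans (pow-cong n inv) (pow-1 n))

  module _ {u u⁻¹ : Carrier} (inv : u * u⁻¹ ≈ 1#) where

    ipow-⊖ : ∀ m n → ipow u u⁻¹ (m ⊖ n) ≈ pow u m * pow u⁻¹ n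
    ipow-⊖ m zero rewrite ℤ.⊖-≥ {m} ℕ.z≤n = sym (*-identityʳ _)
    ipow-⊖ zero (suc n) = sym (*-identityˡ _)
    ipow-⊖ (suc m) (suc n) = begin
      ipow u u⁻¹ (suc m ⊖ suc n)          ≡⟨ ≡.cong (ipow u u⁻¹) (ℤ.[1+m]⊖[1+n]≡m⊖n m n) ⟩
      ipow u u⁻¹ (m ⊖ n)                  ≈⟨ ipow-⊖ m n ⟩
      pow u m * pow u⁻¹ n                 ≈⟨ *-identityˡ _ ⟨
      1# * (pow u m * pow u⁻¹ n)          ≈⟨ *-congʳ inv ⟨
      (u * u⁻¹) * (pow u m * pow u⁻¹ n)   ≈⟨ interchange _ _ _ _ ⟩
      pow u (suc m) * pow u⁻¹ (suc n)     ∎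

    ipow-+ : ∀ i j → ipow u u⁻¹ (i ℤ.+ j) ≈ ipow u u⁻¹ i * ipow u u⁻¹ j
    ipow-+ (+ m)    (+ n)    = pow-+ u m n
    ipow-+ (+ m)    -[1+ n ] = ipow-⊖ m (suc n)
    ipow-+ -[1+ m ] (+ n)    = trans (ipow-⊖ n (suc m)) (*-comm _ _)
    ipow-+ -[1+ m ] -[1+ n ] = begin
      pow u⁻¹ (suc (suc (m ℕ.+ n)))       ≡⟨ ≡.cong (pow u⁻¹ ∘ suc) (ℕ.+-suc m n) ⟨
      pow u⁻¹ (suc m ℕ.+ suc n)           ≈⟨ pow-+ u⁻¹ (suc m) (suc n) ⟩
      pow u⁻¹ (suc m) * pow u⁻¹ (suc n)   ∎

  ipow-neg : ∀ u u⁻¹ i → ipow u u⁻¹ (ℤ.- i) ≡ ipow u⁻¹ u i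
  ipow-neg u u⁻¹ (+ zero)  = ≡.refl
  ipow-neg u u⁻¹ (+ suc n) = ≡.refl
  ipow-neg u u⁻¹ -[1+ n ]  = ≡.refl

  ipow-∸ : ∀ u u⁻¹ {m n} → n ≤ m → ipow u u⁻¹ (+ m ℤ.- + n) ≡ pow u (m ∸ n)
  ipow-∸ u u⁻¹ {m} {n} n≤m = ≡.cong (ipow u u⁻¹) (≡.trans (ℤ.m-n≡m⊖n m n) (ℤ.⊖-≥ n≤m))

  sgn≡ipow : ∀ i → sgn i ≡ ipow (- 1#) (- 1#) i
  sgn≡ipow (+ n)    = ≡.refl
  sgn≡ipow -[1+ n ] = ≡.refl

  -1*-1≈1 : - 1# * - 1# ≈ 1#
  -1*-1≈1 = solve 0 (:- 𝟙 :* :- 𝟙 := 𝟙) refl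

  sgn-split : ∀ m n → sgn (+ m ℤ.- + n) ≈ pow (- 1#) m * pow (- 1#) n
  sgn-split m n = begin
    sgn (+ m ℤ.- + n)                    ≡⟨ sgn≡ipow (+ m ℤ.- + n) ⟩
    ipow (- 1#) (- 1#) (+ m ℤ.- + n)     ≡⟨ ≡.cong (ipow (- 1#) (- 1#)) (ℤ.m-n≡m⊖n m n) ⟩
    ipow (- 1#) (- 1#) (m ⊖ n)           ≈⟨ ipow-⊖ -1*-1≈1 m n ⟩
    pow (- 1#) m * pow (- 1#) n          ∎

  annihilate : ∀ {a x y} → a ≈ 0# → a * x ≈ a * y
  annihilate a≈0 = trans (*-congʳ a≈0) (trans (zeroˡ _) (sym (trans (*-congʳ a≈0) (zeroˡ _))))

  prodF-cong : ∀ {m} {f g : Fin m → Carrier} → (∀ j → f j ≈ g j) → prodF f ≈ prodF g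
  prodF-cong {zero}  f≈g = refl
  prodF-cong {suc m} f≈g = *-cong (f≈g zero) (prodF-cong (f≈g ∘ suc))

  if-cong : ∀ b {x y} → x ≈ y → (if b then x else 0#) ≈ (if b then y else 0#)
  if-cong true  x≈y = x≈y
  if-cong false x≈y = refl

  if-*ˡ : ∀ b x y → (if b then x * y else 0#) ≈ x * (if b then y else 0#)
  if-*ˡ true  x y = refl
  if-*ˡ false x y = sym (zeroʳ x)

  prodF-distrib : ∀ {m} (f g : Fin m → Carrier) → prodF (λ j → f j * g j) ≈ prodF f * prodF g
  prodF-distrib {zero}  f g = sym (*-identityˡ 1#)
  prodF-distrib {suc m} f g = trans (*-congˡ (prodF-distrib (f ∘ suc) (g ∘ suc))) (interchange _ _ _ _)

  prodF-1 : ∀ {m} (f : Fin m → Carrier) → (∀ j → f j ≈ 1#) → prodF f ≈ 1#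
  prodF-1 {zero}  f f≈1 = refl
  prodF-1 {suc m} f f≈1 = trans (*-cong (f≈1 zero) (prodF-1 (f ∘ suc) (f≈1 ∘ suc))) (*-identityˡ 1#)

  sumℕ : ℕ → (ℕ → Carrier) → Carrier
  sumℕ n f = ∑[ i < n ] f (toℕ i)

  sumℕ-cong : ∀ n {f g} → (∀ i → i < n → f i ≈ g i) → sumℕ n f ≈ sumℕ n g
  sumℕ-cong n f≈g = sum-cong-≋ (λ i → f≈g (toℕ i) (Fin.toℕ<n i))

  sumℕ-zero : ∀ n f → (∀ i → i < n → f i ≈ 0#) → sumℕ n f ≈ 0#
  sumℕ-zero n f f≈0 = trans (sumℕ-cong n f≈0) (sum-replicate-zero n)

  sumℕ-*ˡ : ∀ n x f → sumℕ n (λ i → x * f i) ≈ x * sumℕ n f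
  sumℕ-*ˡ n x f = sym (*-distribˡ-sum {n} x (f ∘ toℕ))

  sumℕ-*ʳ : ∀ n f x → sumℕ n (λ i → f i * x) ≈ sumℕ n f * x
  sumℕ-*ʳ n f x = sym (*-distribʳ-sum {n} x (f ∘ toℕ))

  sumℕ-split : ∀ m n f → sumℕ (m ℕ.+ n) f ≈ sumℕ m f + sumℕ n (λ i → f (m ℕ.+ i))
  sumℕ-split zero    n f = sym (+-identityˡ _)
  sumℕ-split (suc m) n f = trans (+-congˡ (sumℕ-split m n (λ i → f (suc i)))) (sym (+-assoc _ _ _))

  sumℕ-telescope : ∀ n g → sumℕ n (λ i → g (suc i) - g i) ≈ g n - g 0
  sumℕ-telescope zero    g = sym (-‿inverseʳ (g 0))
  sumℕ-telescope (suc n) g = begin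
    (g 1 - g 0) + sumℕ n (λ i → g (suc (suc i)) - g (suc i))   ≈⟨ +-congˡ (sumℕ-telescope n (λ i → g (suc i))) ⟩
    (g 1 - g 0) + (g (suc n) - g 1)                           ≈⟨ solve 3 (λ a b c → (b :- a) :+ (c :- b) := c :- a) refl (g 0) (g 1) (g (suc n)) ⟩
    g (suc n) - g 0                                           ∎

  sumℕ-window : ∀ {r a N} f → a ℕ.+ N ≤ r → (∀ b → b < a → f b ≈ 0#) → (∀ b → a ℕ.+ N < b → f b ≈ 0#) →
                sumℕ (suc r) f ≈ sumℕ (suc N) (λ j → f (a ℕ.+ j))
  sumℕ-window {r} {a} {N} f a+N≤r below above = begin
    sumℕ (suc r) f                                   ≡⟨ ≡.cong (λ k → sumℕ k f) suc-r≡ ⟩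
    sumℕ (a ℕ.+ (suc N ℕ.+ e)) f                     ≈⟨ sumℕ-split a _ f ⟩
    sumℕ a f + sumℕ (suc N ℕ.+ e) (f ∘ (a ℕ.+_))     ≈⟨ +-cong (sumℕ-zero a f below) (sumℕ-split (suc N) e (f ∘ (a ℕ.+_))) ⟩
    0# + (window + sumℕ e (λ i → f (a ℕ.+ (suc N ℕ.+ i))))
                                                     ≈⟨ +-identityˡ _ ⟩
    window + sumℕ e (λ i → f (a ℕ.+ (suc N ℕ.+ i)))  ≈⟨ +-congˡ (sumℕ-zero e _ (λ i _ → above _ (beyond i))) ⟩
    window + 0#                                      ≈⟨ +-identityʳ _ ⟩
    window                                           ∎
    where
    e = r ∸ (a ℕ.+ N)
    window = sumℕ (suc N) (λ j → f (a ℕ.+ j))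
    suc-r≡ : suc r ≡ a ℕ.+ (suc N ℕ.+ e)
    suc-r≡ = ≡.trans (≡.cong suc (≡.trans (≡.sym (ℕ.m+[n∸m]≡n a+N≤r)) (ℕ.+-assoc a N e))) (≡.sym (ℕ.+-suc a (N ℕ.+ e)))
    beyond : ∀ i → a ℕ.+ N < a ℕ.+ (suc N ℕ.+ i)
    beyond i = ℕ.+-monoʳ-< a (ℕ.s≤s (ℕ.m≤m+n N i))

  sumV : ∀ m → (Vec Bool m → Carrier) → Carrier
  sumV zero    f = f []
  sumV (suc m) f = sumV m (f ∘ (true ∷_)) + sumV m (f ∘ (false ∷_))

  sumV-cong : ∀ m {f g} → (∀ v → f v ≈ g v) → sumV m f ≈ sumV m g
  sumV-cong zero    f≈g = f≈g []
  sumV-cong (suc m) f≈g = +-cong (sumV-cong m (f≈g ∘ (true ∷_))) (sumV-cong m (f≈g ∘ (false ∷_)))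

  sumV-*ˡ : ∀ m x f → sumV m (λ v → x * f v) ≈ x * sumV m f
  sumV-*ˡ zero    x f = refl
  sumV-*ˡ (suc m) x f = trans (+-cong (sumV-*ˡ m x _) (sumV-*ˡ m x _)) (sym (distribˡ x _ _))

  sumV-+ : ∀ m f g → sumV m (λ v → f v + g v) ≈ sumV m f + sumV m g
  sumV-+ zero    f g = refl
  sumV-+ (suc m) f g = trans (+-cong (sumV-+ m _ _) (sumV-+ m _ _)) (solve 4 (λ a b c d → (a :+ b) :+ (c :+ d) := (a :+ c) :+ (b :+ d)) refl _ _ _ _)

  sumV-zero : ∀ m f → (∀ v → f v ≈ 0#) → sumV m f ≈ 0#
  sumV-zero zero    f f≈0 = f≈0 []
  sumV-zero (suc m) f f≈0 = trans (+-cong (sumV-zero m _ (f≈0 ∘ (true ∷_))) (sumV-zero m _ (f≈0 ∘ (false ∷_)))) (+-identityʳ 0#)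

  sumV-supported : ∀ m f (v : Vec Bool m) → (∀ w → w ≢ v → f w ≈ 0#) → sumV m f ≈ f v
  sumV-supported zero    f []          _   = refl
  sumV-supported (suc m) f (true ∷ v)  f≈0 =
    trans (+-cong (sumV-supported m _ v (λ w w≢v → f≈0 _ (w≢v ∘ Vec.∷-injectiveʳ)))
                  (sumV-zero m _ (λ w → f≈0 _ λ ())))
          (+-identityʳ _)
  sumV-supported (suc m) f (false ∷ v) f≈0 =
    trans (+-cong (sumV-zero m _ (λ w → f≈0 _ λ ()))
                  (sumV-supported m _ v (λ w w≢v → f≈0 _ (w≢v ∘ Vec.∷-injectiveʳ))))
          (+-identityˡ _)

  sum-zero : ∀ {k} (t : Fin k → Carrier) → (∀ i → t i ≈ 0#) → sum t ≈ 0#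
  sum-zero {k} t t≈0 = trans (sum-cong-≋ t≈0) (sum-replicate-zero k)

  sum-supported : ∀ {k} (t : Fin k → Carrier) i → (∀ j → j ≢ i → t j ≈ 0#) → sum t ≈ t i
  sum-supported t zero    t≈0 = trans (+-congˡ (sum-zero _ (λ j → t≈0 (suc j) λ ()))) (+-identityʳ _)
  sum-supported t (suc i) t≈0 =
    trans (+-congʳ (t≈0 zero λ ()))
          (trans (+-identityˡ _) (sum-supported _ i (λ j j≢i → t≈0 (suc j) (j≢i ∘ Fin.suc-injective))))

  module _ {A : Set} where

    sumL-cong : ∀ (L : List A) {f g} → (∀ x → f x ≈ g x) → sumL L f ≈ sumL L g
    sumL-cong []      f≈g = refl
    sumL-cong (x ∷ L) f≈g = +-cong (f≈g x) (sumL-cong L f≈g)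

    sumL-*ˡ : ∀ (L : List A) u f → sumL L (λ x → u * f x) ≈ u * sumL L f
    sumL-*ˡ []      u f = sym (zeroʳ u)
    sumL-*ˡ (x ∷ L) u f = trans (+-congˡ (sumL-*ˡ L u f)) (sym (distribˡ u _ _))

    sumL-zero : ∀ (L : List A) f → (∀ {x} → x ∈ L → f x ≈ 0#) → sumL L f ≈ 0#
    sumL-zero []      f f≈0 = refl
    sumL-zero (x ∷ L) f f≈0 = trans (+-cong (f≈0 (here ≡.refl)) (sumL-zero L f (f≈0 ∘ there))) (+-identityʳ 0#)

    sumL-supported : ∀ {L : List A} {y} f → Unique L → y ∈ L → (∀ x → x ≢ y → f x ≈ 0#) → sumL L f ≈ f y
    sumL-supported {x ∷ L} f (x∉L ∷ _) (here ≡.refl) f≈0 =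
      trans (+-congˡ (sumL-zero L f (λ z∈L → f≈0 _ (≢-sym (All.lookup x∉L z∈L))))) (+-identityʳ _)
    sumL-supported {x ∷ L} f (x∉L ∷ L-unique) (there y∈L) f≈0 =
      trans (+-congʳ (f≈0 x (All.lookup x∉L y∈L))) (trans (+-identityˡ _) (sumL-supported f L-unique y∈L f≈0))

  module _ {n r : ℕ} where

    sumP : (P n r → Carrier) → Carrier
    sumP f = ∑[ i < suc r ] sumV n (λ v → f (i , v))

    sumP-cong : ∀ {f g} → (∀ a → f a ≈ g a) → sumP f ≈ sumP g
    sumP-cong f≈g = sum-cong-≋ (λ i → sumV-cong n (λ v → f≈g (i , v)))

    sumP-+ : ∀ f g → sumP (λ a → f a + g a) ≈ sumP f + sumP g
    sumP-+ f g = trans (sum-cong-≋ (λ i → sumV-+ n (λ v → f (i , v)) (λ v → g (i , v))))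
                       (∑-distrib-+ (λ i → sumV n (λ v → f (i , v))) (λ i → sumV n (λ v → g (i , v))))

    sumP-zero : sumP (λ _ → 0#) ≈ 0#
    sumP-zero = sum-zero {suc r} (λ _ → sumV n (λ _ → 0#)) (λ _ → sumV-zero n (λ _ → 0#) (λ _ → refl))

    sumP-supported : ∀ f b → (∀ a → a ≢ b → f a ≈ 0#) → sumP f ≈ f b
    sumP-supported f (i , v) f≈0 =
      trans (sum-supported (λ j → sumV n (λ w → f (j , w))) i
                           (λ j j≢i → sumV-zero n (λ w → f (j , w)) (λ w → f≈0 (j , w) (j≢i ∘ ≡.cong proj₁))))
            (sumV-supported n (λ w → f (i , w)) v (λ w w≢v → f≈0 (i , w) (w≢v ∘ ≡.cong proj₂)))

    sumL-sumP-comm : ∀ (L : List (P n r)) (g : P n r → P n r → Carrier) →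
                     sumL L (λ b → sumP (g b)) ≈ sumP (λ a → sumL L (λ b → g b a))
    sumL-sumP-comm []      g = sym sumP-zero
    sumL-sumP-comm (b ∷ L) g = trans (+-congˡ (sumL-sumP-comm L g)) (sym (sumP-+ (g b) (λ a → sumL L (λ b′ → g b′ a))))

    δ : P n r → P n r → Carrier
    δ a b = if does (a ≟P b) then 1# else 0#

    δ-refl : ∀ a → δ a a ≈ 1#
    δ-refl a with a ≟P a
    ... | yes _  = refl
    ... | no a≢a = contradiction ≡.refl a≢a

    δ-≢ : ∀ {a b} → a ≢ b → δ a b ≈ 0#
    δ-≢ {a} {b} a≢b with a ≟P b
    ... | yes a≡b = contradiction a≡b a≢b
    ... | no _    = refl

    sumL-enumeration : ∀ {L : List (P n r)} → Unique L → (∀ a → a ∈ L) → ∀ f → sumL L f ≈ sumP f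
    sumL-enumeration {L} L-unique complete f = begin
      sumL L f                                  ≈⟨ sumL-cong L (λ b → sumP-δ b) ⟨
      sumL L (λ b → sumP (λ a → δ b a * f a))   ≈⟨ sumL-sumP-comm L (λ b a → δ b a * f a) ⟩
      sumP (λ a → sumL L (λ b → δ b a * f a))   ≈⟨ sumP-cong (λ a → sumL-δ a) ⟩
      sumP f                                    ∎
      where
      δ-≢-* : ∀ {a b} → a ≢ b → δ a b * f b ≈ 0#
      δ-≢-* {a} {b} a≢b = trans (*-congʳ (δ-≢ a≢b)) (zeroˡ (f b))
      δ-refl-* : ∀ a → δ a a * f a ≈ f a
      δ-refl-* a = trans (*-congʳ (δ-refl a)) (*-identityˡ (f a))
      sumP-δ : ∀ b → sumP (λ a → δ b a * f a) ≈ f b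
      sumP-δ b = trans (sumP-supported _ b (λ a a≢b → δ-≢-* (≢-sym a≢b))) (δ-refl-* b)
      sumL-δ : ∀ a → sumL L (λ b → δ b a * f a) ≈ f a
      sumL-δ a = trans (sumL-supported _ L-unique (complete a) (λ b b≢a → δ-≢-* b≢a)) (δ-refl-* a)

  -- Gaussian binomials

  module _ (q : Carrier) where

    gbinom-vanishes : ∀ {m k} → m < k → gbinom q m k ≈ 0#
    gbinom-vanishes {zero}  {suc k} _ = refl
    gbinom-vanishes {suc m} {suc k} (s≤s m<k) =
      trans (+-cong (gbinom-vanishes m<k) (trans (*-congˡ (gbinom-vanishes (ℕ.m<n⇒m<1+n m<k))) (zeroʳ _))) (+-identityʳ 0#)

    gbinom-diagonal : ∀ m → gbinom q m m ≈ 1#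
    gbinom-diagonal zero    = refl
    gbinom-diagonal (suc m) =
      trans (+-cong (gbinom-diagonal m) (trans (*-congˡ (gbinom-vanishes (ℕ.n<1+n m))) (zeroʳ _))) (+-identityʳ 1#)

    gbinom-pascal′ : ∀ m k → gbinom q (suc m) (suc k) ≈ pow q (m ∸ k) * gbinom q m k + gbinom q m (suc k)
    gbinom-pascal′ zero zero    = solve 1 (λ q → 𝟙 :+ q :* 𝟙 :* 𝟘 := 𝟙 :* 𝟙 :+ 𝟘) refl q
    gbinom-pascal′ zero (suc k) = trans (trans (+-identityˡ _) (zeroʳ _)) (sym (trans (+-identityʳ _) (zeroʳ _)))
    gbinom-pascal′ (suc m) zero = begin
      1# + q * 1# * gbinom q (suc m) 1                        ≈⟨ +-congˡ (*-congˡ (gbinom-pascal′ m zero)) ⟩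
      1# + q * 1# * (pow q m * 1# + gbinom q m 1)             ≈⟨ solve 3 (λ q p g → 𝟙 :+ q :* 𝟙 :* (p :* 𝟙 :+ g)
                                                                                := q :* p :* 𝟙 :+ (𝟙 :+ q :* 𝟙 :* g)) refl q (pow q m) (gbinom q m 1) ⟩
      pow q (suc m) * 1# + gbinom q (suc m) 1                 ∎
    gbinom-pascal′ (suc m) (suc k) = begin
      gbinom q (suc m) (suc k) + q * Q * gbinom q (suc m) (suc (suc k))
                                                              ≈⟨ +-cong (gbinom-pascal′ m k) (*-congˡ (gbinom-pascal′ m (suc k))) ⟩
      (A * G₀ + G₁) + q * Q * (pow q (m ∸ suc k) * G₁ + G₂)    ≈⟨ solve 7 (λ q Q A B G₀ G₁ G₂ → (A :* G₀ :+ G₁) :+ q :* Q :* (B :+ G₂)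
                                                                          := A :* G₀ :+ Q :* (q :* B) :+ (G₁ :+ q :* Q :* G₂))
                                                                  refl q Q A (pow q (m ∸ suc k) * G₁) G₀ G₁ G₂ ⟩
      A * G₀ + Q * (q * (pow q (m ∸ suc k) * G₁)) + (G₁ + q * Q * G₂)
                                                              ≈⟨ +-congʳ (+-congˡ (*-congˡ shift)) ⟩
      A * G₀ + Q * (A * G₁) + (G₁ + q * Q * G₂)                ≈⟨ solve 6 (λ Q A G₀ G₁ G₂ R → A :* G₀ :+ Q :* (A :* G₁) :+ R := A :* (G₀ :+ Q :* G₁) :+ R)
                                                                  refl Q A G₀ G₁ G₂ (G₁ + q * Q * G₂) ⟩
      A * (G₀ + Q * G₁) + (G₁ + q * Q * G₂)                    ∎
      where
      Q = pow q (suc k)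
      A = pow q (m ∸ k)
      G₀ = gbinom q m k
      G₁ = gbinom q m (suc k)
      G₂ = gbinom q m (suc (suc k))
      shift : q * (pow q (m ∸ suc k) * G₁) ≈ A * G₁
      shift with ℕ.<-≤-connex k m
      ... | inj₁ (s≤s {n = m′} k≤m′) rewrite ℕ.+-∸-assoc 1 k≤m′ = sym (*-assoc _ _ _)
      ... | inj₂ m≤k = trans (*-congˡ (trans (*-congˡ G₁≈0) (zeroʳ _))) (trans (zeroʳ q) (sym (trans (*-congˡ G₁≈0) (zeroʳ _))))
        where G₁≈0 = gbinom-vanishes (s≤s m≤k)

  module _ {u u⁻¹ : Carrier} (inv : u * u⁻¹ ≈ 1#) where

    gbinom-⁻¹ : ∀ k d → pow u (k ℕ.* d) * gbinom u⁻¹ (k ℕ.+ d) k ≈ gbinom u (k ℕ.+ d) k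
    gbinom-⁻¹ zero d = *-identityˡ _
    gbinom-⁻¹ (suc k) zero rewrite ℕ.*-zeroʳ k | ℕ.+-identityʳ k =
      trans (*-identityˡ _) (trans (gbinom-diagonal u⁻¹ (suc k)) (sym (gbinom-diagonal u (suc k))))
    gbinom-⁻¹ (suc k) (suc d) = begin
      pow u (suc d ℕ.+ k ℕ.* suc d) * (gbinom u⁻¹ m k + pow u⁻¹ (suc k) * gbinom u⁻¹ m (suc k))
                                                          ≈⟨ distribˡ _ _ _ ⟩
      pow u (suc d ℕ.+ k ℕ.* suc d) * gbinom u⁻¹ m k + pow u (suc k ℕ.* suc d) * (pow u⁻¹ (suc k) * gbinom u⁻¹ m (suc k))
                                                          ≈⟨ +-cong lower upper ⟩
      pow u (suc d) * gbinom u m k + gbinom u m (suc k)   ≡⟨ ≡.cong (λ e → pow u e * gbinom u m k + gbinom u m (suc k)) (ℕ.m+n∸m≡n k (suc d)) ⟨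
      pow u (m ∸ k) * gbinom u m k + gbinom u m (suc k)   ≈⟨ gbinom-pascal′ u m k ⟨
      gbinom u (suc m) (suc k)                            ∎
      where
      m = k ℕ.+ suc d
      lower : pow u (suc d ℕ.+ k ℕ.* suc d) * gbinom u⁻¹ m k ≈ pow u (suc d) * gbinom u m k
      lower = trans (*-congʳ (pow-+ u (suc d) _)) (trans (*-assoc _ _ _) (*-congˡ (gbinom-⁻¹ k (suc d))))
      upper : pow u (suc k ℕ.* suc d) * (pow u⁻¹ (suc k) * gbinom u⁻¹ m (suc k)) ≈ gbinom u m (suc k)
      upper = begin
        pow u (suc k ℕ.* suc d) * (pow u⁻¹ (suc k) * gbinom u⁻¹ m (suc k))
          ≡⟨ ≡.cong₂ (λ e m′ → pow u e * (pow u⁻¹ (suc k) * gbinom u⁻¹ m′ (suc k)))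
                     (≡.trans (ℕ.*-suc (suc k) d) (ℕ.+-comm (suc k) _)) (ℕ.+-suc k d) ⟩
        pow u (suc k ℕ.* d ℕ.+ suc k) * (pow u⁻¹ (suc k) * G)
          ≈⟨ *-congʳ (pow-+ u (suc k ℕ.* d) (suc k)) ⟩
        (pow u (suc k ℕ.* d) * pow u (suc k)) * (pow u⁻¹ (suc k) * G)
          ≈⟨ solve 4 (λ a b c g → (a :* b) :* (c :* g) := a :* ((b :* c) :* g)) refl _ _ _ _ ⟩
        pow u (suc k ℕ.* d) * ((pow u (suc k) * pow u⁻¹ (suc k)) * G)
          ≈⟨ *-congˡ (trans (*-congʳ (pow-inverse inv (suc k))) (*-identityˡ G)) ⟩
        pow u (suc k ℕ.* d) * G
          ≈⟨ gbinom-⁻¹ (suc k) d ⟩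
        gbinom u (suc k ℕ.+ d) (suc k)
          ≡⟨ ≡.cong (λ m′ → gbinom u m′ (suc k)) (ℕ.+-suc k d) ⟨
        gbinom u m (suc k) ∎
        where G = gbinom u⁻¹ (suc k ℕ.+ d) (suc k)

  module _ (q : Carrier) where

    gbinom-trinomial : ∀ a j k → gbinom q (a ℕ.+ j ℕ.+ k) (a ℕ.+ j) * gbinom q (a ℕ.+ j) a
                                 ≈ gbinom q (a ℕ.+ j ℕ.+ k) a * gbinom q (j ℕ.+ k) j
    gbinom-trinomial zero j k = *-comm _ _
    gbinom-trinomial (suc a) zero k rewrite ℕ.+-identityʳ a = *-congˡ (gbinom-diagonal q (suc a))
    gbinom-trinomial (suc a) (suc j) zero rewrite ℕ.+-identityʳ (a ℕ.+ suc j) | ℕ.+-identityʳ j =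
      trans (*-congʳ (gbinom-diagonal q (suc (a ℕ.+ suc j))))
            (trans (*-identityˡ _) (sym (trans (*-congˡ (gbinom-diagonal q (suc j))) (*-identityʳ _))))
    gbinom-trinomial (suc a) (suc j) (suc k) = begin
      (X₁ + qB * X₂) * (Y₁ + qa * Y₂)                       ≈⟨ solve 6 (λ X₁ X₂ Y₁ Y₂ qa qB → (X₁ :+ qB :* X₂) :* (Y₁ :+ qa :* Y₂)
                                                                    := X₁ :* Y₁ :+ qa :* (X₁ :* Y₂) :+ qB :* (X₂ :* (Y₁ :+ qa :* Y₂)))
                                                               refl X₁ X₂ Y₁ Y₂ qa qB ⟩
      X₁ * Y₁ + qa * (X₁ * Y₂) + qB * (X₂ * (Y₁ + qa * Y₂)) ≈⟨ +-cong (+-cong (gbinom-trinomial a (suc j) (suc k)) (*-congˡ lower))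
                                                                      (*-cong (pow-+ q (suc a) (suc j)) upper) ⟩
      Cₐ * (V₁ + qj * V₂) + qa * (Cₛ * V₁) + (qa * qj) * (Cₛ * V₂)
                                                            ≈⟨ solve 6 (λ Cₐ Cₛ V₁ V₂ qa qj → Cₐ :* (V₁ :+ qj :* V₂) :+ qa :* (Cₛ :* V₁) :+ (qa :* qj) :* (Cₛ :* V₂)
                                                                    := (Cₐ :+ qa :* Cₛ) :* (V₁ :+ qj :* V₂))
                                                               refl Cₐ Cₛ V₁ V₂ qa qj ⟩
      (Cₐ + qa * Cₛ) * (V₁ + qj * V₂)                       ∎
      where
      b = a ℕ.+ suc j
      m = b ℕ.+ suc k
      X₁ = gbinom q m b
      X₂ = gbinom q m (suc b)
      Y₁ = gbinom q b a
      Y₂ = gbinom q b (suc a)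
      Cₐ = gbinom q m a
      Cₛ = gbinom q m (suc a)
      V₁ = gbinom q (j ℕ.+ suc k) j
      V₂ = gbinom q (j ℕ.+ suc k) (suc j)
      qa = pow q (suc a)
      qj = pow q (suc j)
      qB = pow q (suc b)
      b≡ : b ≡ suc (a ℕ.+ j)
      b≡ = ℕ.+-suc a j
      lower : X₁ * Y₂ ≈ Cₛ * V₁
      lower = begin
        X₁ * Y₂                                                           ≡⟨ ≡.cong (λ b′ → gbinom q (b′ ℕ.+ suc k) b′ * gbinom q b′ (suc a)) b≡ ⟩
        gbinom q (suc a ℕ.+ j ℕ.+ suc k) (suc a ℕ.+ j) * gbinom q (suc a ℕ.+ j) (suc a)
                                                                          ≈⟨ gbinom-trinomial (suc a) j (suc k) ⟩
        gbinom q (suc a ℕ.+ j ℕ.+ suc k) (suc a) * V₁                      ≡⟨ ≡.cong (λ b′ → gbinom q (b′ ℕ.+ suc k) (suc a) * V₁) b≡ ⟨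
        Cₛ * V₁                                                           ∎
      upper : X₂ * (Y₁ + qa * Y₂) ≈ Cₛ * V₂
      upper = begin
        gbinom q m (suc b) * gbinom q (suc b) (suc a)                     ≡⟨ ≡.cong (λ m′ → gbinom q m′ (suc b) * gbinom q (suc b) (suc a)) (ℕ.+-suc b k) ⟩
        gbinom q (suc a ℕ.+ suc j ℕ.+ k) (suc a ℕ.+ suc j) * gbinom q (suc a ℕ.+ suc j) (suc a)
                                                                          ≈⟨ gbinom-trinomial (suc a) (suc j) k ⟩
        gbinom q (suc a ℕ.+ suc j ℕ.+ k) (suc a) * gbinom q (suc j ℕ.+ k) (suc j)
                                                                          ≡⟨ ≡.cong₂ (λ m′ l → gbinom q m′ (suc a) * gbinom q l (suc j)) (ℕ.+-suc b k) (ℕ.+-suc j k) ⟨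
        Cₛ * V₂                                                           ∎

  κ : Carrier → ℕ → Carrier
  κ q d = pow (- 1#) d * pow q (d C 2)

  κ-suc : ∀ q d → κ q (suc d) ≈ - (pow q d * κ q d)
  κ-suc q d = begin
    (- 1# * pow (- 1#) d) * pow q (suc d C 2)        ≡⟨ ≡.cong (λ e → (- 1# * pow (- 1#) d) * pow q e) (C2-suc d) ⟩
    (- 1# * pow (- 1#) d) * pow q (d ℕ.+ d C 2)      ≈⟨ *-congˡ (pow-+ q d (d C 2)) ⟩
    (- 1# * pow (- 1#) d) * (pow q d * pow q (d C 2)) ≈⟨ solve 3 (λ s a t → (:- 𝟙 :* s) :* (a :* t) := :- (a :* (s :* t))) refl _ _ _ ⟩
    - (pow q d * κ q d)                               ∎

  gbinom-alternating : ∀ q N → sumℕ (suc (suc N)) (λ j → gbinom q (suc N) j * κ q (suc N ∸ j)) ≈ 0#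
  gbinom-alternating q N = begin
    1# * κ q (suc N) + sumℕ (suc N) (λ j → gbinom q (suc N) (suc j) * κ q (N ∸ j))
                                                    ≈⟨ +-congˡ (sumℕ-cong (suc N) step) ⟩
    1# * κ q (suc N) + sumℕ (suc N) (λ j → Z (suc j) - Z j)
                                                    ≈⟨ +-congˡ (sumℕ-telescope (suc N) Z) ⟩
    1# * κ q (suc N) + (Z (suc N) - 1# * κ q (suc N))
                                                    ≈⟨ +-congˡ (+-congʳ (trans (*-congʳ (gbinom-vanishes q (ℕ.n<1+n N))) (zeroˡ _))) ⟩
    1# * κ q (suc N) + (0# - 1# * κ q (suc N))      ≈⟨ solve 1 (λ s → 𝟙 :* s :+ (𝟘 :- 𝟙 :* s) := 𝟘) refl _ ⟩
    0#                                              ∎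
    where
    Z : ℕ → Carrier
    Z j = gbinom q N j * κ q (suc N ∸ j)
    step : ∀ j → j < suc N → gbinom q (suc N) (suc j) * κ q (N ∸ j) ≈ Z (suc j) - Z j
    step j (s≤s j≤N) = begin
      gbinom q (suc N) (suc j) * κ q (N ∸ j)                              ≈⟨ *-congʳ (gbinom-pascal′ q N j) ⟩
      (pow q (N ∸ j) * gbinom q N j + gbinom q N (suc j)) * κ q (N ∸ j)   ≈⟨ solve 4 (λ a g h s → (a :* g :+ h) :* s := h :* s :- g :* :- (a :* s)) refl _ _ _ _ ⟩
      Z (suc j) - gbinom q N j * - (pow q (N ∸ j) * κ q (N ∸ j))          ≈⟨ +-congˡ (-‿cong (*-congˡ (sym shift))) ⟩
      Z (suc j) - Z j                                                     ∎
      where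
      shift : κ q (suc N ∸ j) ≈ - (pow q (N ∸ j) * κ q (N ∸ j))
      shift = trans (reflexive (≡.cong (κ q) (ℕ.+-∸-assoc 1 j≤N))) (κ-suc q (N ∸ j))

  -- The Y₀-part of m_bc.
  θ⁻¹ : Carrier → Carrier → ℕ → ℕ → Carrier
  θ⁻¹ u u⁻¹ b c = (pow (- 1#) c * pow (- 1#) b) * ipow u u⁻¹ (+ (c C 2) ℤ.- + (b C 2)) * gbinom u⁻¹ c b

  module _ {u u⁻¹ : Carrier} (inv : u * u⁻¹ ≈ 1#) where

    θ⁻¹-vanishes : ∀ {b c} → c < b → θ⁻¹ u u⁻¹ b c ≈ 0#
    θ⁻¹-vanishes c<b = trans (*-congˡ (gbinom-vanishes u⁻¹ c<b)) (zeroʳ _)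

    θ⁻¹-shift : ∀ b d → θ⁻¹ u u⁻¹ b (b ℕ.+ d) ≈ κ u d * gbinom u (b ℕ.+ d) b
    θ⁻¹-shift b d = begin
      (pow (- 1#) (b ℕ.+ d) * pow (- 1#) b) * ipow u u⁻¹ (+ ((b ℕ.+ d) C 2) ℤ.- + (b C 2)) * gbinom u⁻¹ (b ℕ.+ d) b
                                                   ≈⟨ *-congʳ (*-cong sign (reflexive (ipow-∸ u u⁻¹ C2-mono))) ⟩
      pow (- 1#) d * pow u ((b ℕ.+ d) C 2 ∸ b C 2) * gbinom u⁻¹ (b ℕ.+ d) b
                                                   ≡⟨ ≡.cong (λ e → pow (- 1#) d * pow u e * gbinom u⁻¹ (b ℕ.+ d) b) exponent ⟩
      pow (- 1#) d * pow u (b ℕ.* d ℕ.+ d C 2) * gbinom u⁻¹ (b ℕ.+ d) b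
                                                   ≈⟨ *-congʳ (*-congˡ (pow-+ u (b ℕ.* d) (d C 2))) ⟩
      pow (- 1#) d * (pow u (b ℕ.* d) * pow u (d C 2)) * gbinom u⁻¹ (b ℕ.+ d) b
                                                   ≈⟨ solve 4 (λ s a t g → s :* (a :* t) :* g := (s :* t) :* (a :* g)) refl _ _ _ _ ⟩
      κ u d * (pow u (b ℕ.* d) * gbinom u⁻¹ (b ℕ.+ d) b)
                                                   ≈⟨ *-congˡ (gbinom-⁻¹ inv b d) ⟩
      κ u d * gbinom u (b ℕ.+ d) b                 ∎
      where
      sign : pow (- 1#) (b ℕ.+ d) * pow (- 1#) b ≈ pow (- 1#) d
      sign = begin
        pow (- 1#) (b ℕ.+ d) * pow (- 1#) b        ≈⟨ *-congʳ (trans (reflexive (≡.cong (pow (- 1#)) (ℕ.+-comm b d))) (pow-+ (- 1#) d b)) ⟩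
        pow (- 1#) d * pow (- 1#) b * pow (- 1#) b ≈⟨ *-assoc _ _ _ ⟩
        pow (- 1#) d * (pow (- 1#) b * pow (- 1#) b) ≈⟨ *-congˡ (pow-inverse -1*-1≈1 b) ⟩
        pow (- 1#) d * 1#                          ≈⟨ *-identityʳ _ ⟩
        pow (- 1#) d                               ∎
      C2-mono : b C 2 ≤ (b ℕ.+ d) C 2
      C2-mono = ≡.subst (b C 2 ≤_) (≡.sym (C2-+ b d)) (ℕ.m≤m+n _ _)
      exponent : (b ℕ.+ d) C 2 ∸ b C 2 ≡ b ℕ.* d ℕ.+ d C 2
      exponent = ≡.trans (≡.cong (_∸ b C 2) (C2-+ b d)) (ℕ.m+n∸m≡n (b C 2) _)

    θθ⁻¹-window : ∀ {r} a N → a ℕ.+ N ≤ r →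
                  sumℕ (suc r) (λ b → gbinom u b a * θ⁻¹ u u⁻¹ b (a ℕ.+ N))
                  ≈ gbinom u (a ℕ.+ N) a * sumℕ (suc N) (λ j → gbinom u N j * κ u (N ∸ j))
    θθ⁻¹-window {r} a N a+N≤r = begin
      sumℕ (suc r) (λ b → gbinom u b a * θ⁻¹ u u⁻¹ b (a ℕ.+ N))
               ≈⟨ sumℕ-window {r} {a} {N} _ a+N≤r (λ b b<a → trans (*-congʳ (gbinom-vanishes u b<a)) (zeroˡ _))
                                      (λ b a+N<b → trans (*-congˡ (θ⁻¹-vanishes a+N<b)) (zeroʳ _)) ⟩
      sumℕ (suc N) (λ j → gbinom u (a ℕ.+ j) a * θ⁻¹ u u⁻¹ (a ℕ.+ j) (a ℕ.+ N))
               ≈⟨ sumℕ-cong (suc N) (λ j j≤N → term j (ℕ.≤-pred j≤N)) ⟩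
      sumℕ (suc N) (λ j → gbinom u (a ℕ.+ N) a * (gbinom u N j * κ u (N ∸ j)))
               ≈⟨ sumℕ-*ˡ (suc N) _ (λ j → gbinom u N j * κ u (N ∸ j)) ⟩
      gbinom u (a ℕ.+ N) a * sumℕ (suc N) (λ j → gbinom u N j * κ u (N ∸ j)) ∎
      where
      term : ∀ j → j ≤ N → gbinom u (a ℕ.+ j) a * θ⁻¹ u u⁻¹ (a ℕ.+ j) (a ℕ.+ N)
                           ≈ gbinom u (a ℕ.+ N) a * (gbinom u N j * κ u (N ∸ j))
      term j j≤N rewrite ≡.sym (ℕ.m+[n∸m]≡n j≤N) | ℕ.m+n∸m≡n j (N ∸ j) | ≡.sym (ℕ.+-assoc a j (N ∸ j)) = begin
        G₀ * θ⁻¹ u u⁻¹ (a ℕ.+ j) (a ℕ.+ j ℕ.+ k)     ≈⟨ *-congˡ (θ⁻¹-shift (a ℕ.+ j) k) ⟩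
        G₀ * (κ u k * G₁)                             ≈⟨ solve 3 (λ x s y → x :* (s :* y) := s :* (y :* x)) refl G₀ (κ u k) G₁ ⟩
        κ u k * (G₁ * G₀)                             ≈⟨ *-congˡ (gbinom-trinomial u a j k) ⟩
        κ u k * (gbinom u (a ℕ.+ j ℕ.+ k) a * gbinom u (j ℕ.+ k) j)
                                                      ≈⟨ solve 3 (λ s x y → s :* (x :* y) := x :* (y :* s)) refl _ _ _ ⟩
        gbinom u (a ℕ.+ j ℕ.+ k) a * (gbinom u (j ℕ.+ k) j * κ u k) ∎
        where
        k = N ∸ j
        G₀ = gbinom u (a ℕ.+ j) a
        G₁ = gbinom u (a ℕ.+ j ℕ.+ k) (a ℕ.+ j)

    θθ⁻¹-diagonal : ∀ {r} a → a ≤ r → sumℕ (suc r) (λ b → gbinom u b a * θ⁻¹ u u⁻¹ b a) ≈ 1#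
    θθ⁻¹-diagonal {r} a a≤r = begin
      sumℕ (suc r) (λ b → gbinom u b a * θ⁻¹ u u⁻¹ b a)         ≡⟨ ≡.cong (λ c → sumℕ (suc r) (λ b → gbinom u b a * θ⁻¹ u u⁻¹ b c)) a≡a+0 ⟩
      sumℕ (suc r) (λ b → gbinom u b a * θ⁻¹ u u⁻¹ b (a ℕ.+ 0)) ≈⟨ θθ⁻¹-window a 0 (≡.subst (_≤ r) a≡a+0 a≤r) ⟩
      gbinom u (a ℕ.+ 0) a * (1# * (1# * 1#) + 0#)              ≡⟨ ≡.cong (λ m → gbinom u m a * (1# * (1# * 1#) + 0#)) a≡a+0 ⟨
      gbinom u a a * (1# * (1# * 1#) + 0#)                      ≈⟨ *-congʳ (gbinom-diagonal u a) ⟩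
      1# * (1# * (1# * 1#) + 0#)                                ≈⟨ solve 0 (𝟙 :* (𝟙 :* (𝟙 :* 𝟙) :+ 𝟘) := 𝟙) refl ⟩
      1#                                                        ∎
      where
      a≡a+0 : a ≡ a ℕ.+ 0
      a≡a+0 = ≡.sym (ℕ.+-identityʳ a)

    θθ⁻¹-offdiagonal : ∀ {r} a c → c ≤ r → a ≢ c → sumℕ (suc r) (λ b → gbinom u b a * θ⁻¹ u u⁻¹ b c) ≈ 0#
    θθ⁻¹-offdiagonal {r} a c c≤r a≢c with ℕ.<-cmp a c
    ... | tri≈ _ a≡c _ = contradiction a≡c a≢c
    ... | tri> _ _ c<a = sumℕ-zero (suc r) _ (λ b _ → term b)
      where
      term : ∀ b → gbinom u b a * θ⁻¹ u u⁻¹ b c ≈ 0#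
      term b with ℕ.<-≤-connex b a
      ... | inj₁ b<a = trans (*-congʳ (gbinom-vanishes u b<a)) (zeroˡ _)
      ... | inj₂ a≤b = trans (*-congˡ (θ⁻¹-vanishes (ℕ.<-≤-trans c<a a≤b))) (zeroʳ _)
    ... | tri< a<c _ _ =
      ≡.subst (λ c → sumℕ (suc r) (λ b → gbinom u b a * θ⁻¹ u u⁻¹ b c) ≈ 0#) c≡
        (trans (θθ⁻¹-window a (suc N) (≡.subst (_≤ r) (≡.sym c≡) c≤r))
               (trans (*-congˡ (gbinom-alternating u N)) (zeroʳ _)))
      where
      N = c ∸ suc a
      c≡ : a ℕ.+ suc N ≡ c
      c≡ = ≡.trans (ℕ.+-suc a N) (ℕ.m+[n∸m]≡n a<c)

  -- Prefix weights

  LocalWeight : ℕ → Set c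
  LocalWeight m = Fin m → Bool → Bool → ℕ → Carrier

  -- The bit part of z and m.  The offsets s and t carry the prefix sums of the two indices, so
  -- t ∸ s is Δ_i, and the guards s ≤ᵇ t check ≤_t one prefix at a time.
  prefixWeight : ∀ {m} → LocalWeight m → ℕ → Vec Bool m → ℕ → Vec Bool m → Carrier
  prefixWeight ω s []       t []       = if s ≤ᵇ t then 1# else 0#
  prefixWeight ω s (x ∷ xs) t (y ∷ ys) =
    if s ≤ᵇ t then ω zero x y (t ∸ s) * prefixWeight (ω ∘ suc) (s ℕ.+ b2n x) xs (t ℕ.+ b2n y) ys else 0#

  prefixWeight-∷ : ∀ {m} (ω : LocalWeight (suc m)) {s t} x (xs : Vec Bool m) y ys → s ≤ t →
                   prefixWeight ω s (x ∷ xs) t (y ∷ ys)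
                   ≡ ω zero x y (t ∸ s) * prefixWeight (ω ∘ suc) (s ℕ.+ b2n x) xs (t ℕ.+ b2n y) ys
  prefixWeight-∷ ω x xs y ys s≤t rewrite ≤ᵇ-true s≤t = ≡.refl

  prefixWeight-[] : ∀ {s t} (ω : LocalWeight 0) → s ≤ t → prefixWeight ω s [] t [] ≡ 1#
  prefixWeight-[] ω s≤t rewrite ≤ᵇ-true s≤t = ≡.refl

  prefixWeight-≰ : ∀ {m} (ω : LocalWeight m) {s t} xs ys → ¬ s ≤ t → prefixWeight ω s xs t ys ≡ 0#
  prefixWeight-≰ ω []       []       s≰t rewrite ≤ᵇ-false s≰t = ≡.refl
  prefixWeight-≰ ω (x ∷ xs) (y ∷ ys) s≰t rewrite ≤ᵇ-false s≰t = ≡.refl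

  prefixWeight-∑ : ∀ {m} (ω₁ ω₂ ω₃ : LocalWeight m) →
    (∀ j x z d e → ω₁ j x true d * ω₂ j true z e + ω₁ j x false d * ω₂ j false z e ≈ ω₃ j x z (d ℕ.+ e)) →
    (∀ j → ω₁ j true false 0 ≈ 0#) →
    (∀ j → ω₂ j true false 0 ≈ 0#) →
    ∀ {s t u} xs zs → s ≤ t → t ≤ u →
    sumV m (λ ys → prefixWeight ω₁ s xs t ys * prefixWeight ω₂ t ys u zs) ≈ prefixWeight ω₃ s xs u zs
  prefixWeight-∑ ω₁ ω₂ ω₃ _ _ _ [] [] s≤t t≤u
    rewrite prefixWeight-[] ω₁ s≤t | prefixWeight-[] ω₂ t≤u | prefixWeight-[] ω₃ (ℕ.≤-trans s≤t t≤u) = *-identityʳ 1#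
  prefixWeight-∑ {suc m} ω₁ ω₂ ω₃ compose vanish₁ vanish₂ {s} {t} {u} (x ∷ xs) (z ∷ zs) s≤t t≤u = begin
    sumV m (λ ys → W₁ true ys * W₂ true ys) + sumV m (λ ys → W₁ false ys * W₂ false ys)
                                                      ≈⟨ +-cong (branch true) (branch false) ⟩
    coefficient true * rest + coefficient false * rest ≈⟨ distribʳ rest _ _ ⟨
    (coefficient true + coefficient false) * rest     ≈⟨ *-congʳ (compose zero x z (t ∸ s) (u ∸ t)) ⟩
    ω₃ zero x z ((t ∸ s) ℕ.+ (u ∸ t)) * rest          ≡⟨ ≡.cong (λ d → ω₃ zero x z d * rest) (∸-+-∸ s≤t t≤u) ⟩
    ω₃ zero x z (u ∸ s) * rest                        ≡⟨ prefixWeight-∷ ω₃ x xs z zs (ℕ.≤-trans s≤t t≤u) ⟨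
    prefixWeight ω₃ s (x ∷ xs) u (z ∷ zs)             ∎
    where
    W₁ W₁′ W₂ W₂′ : Bool → Vec Bool m → Carrier
    W₁ y ys = prefixWeight ω₁ s (x ∷ xs) t (y ∷ ys)
    W₂ y ys = prefixWeight ω₂ t (y ∷ ys) u (z ∷ zs)
    W₁′ y ys = prefixWeight (ω₁ ∘ suc) (s ℕ.+ b2n x) xs (t ℕ.+ b2n y) ys
    W₂′ y ys = prefixWeight (ω₂ ∘ suc) (t ℕ.+ b2n y) ys (u ℕ.+ b2n z) zs
    coefficient : Bool → Carrier
    coefficient y = ω₁ zero x y (t ∸ s) * ω₂ zero y z (u ∸ t)
    rest = prefixWeight (ω₃ ∘ suc) (s ℕ.+ b2n x) xs (u ℕ.+ b2n z) zs
    -- If a guard of the recursive call fails, the coefficient contains ω₁ or ω₂ at (true, false, 0).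
    inner : ∀ y → coefficient y * sumV m (λ ys → W₁′ y ys * W₂′ y ys) ≈ coefficient y * rest
    inner y with step-≤ s≤t x y | step-≤ t≤u y z
    ... | inj₁ s≤t′ | inj₁ t≤u′ =
      *-congˡ (prefixWeight-∑ (ω₁ ∘ suc) (ω₂ ∘ suc) (ω₃ ∘ suc) (compose ∘ suc) (vanish₁ ∘ suc) (vanish₂ ∘ suc) xs zs s≤t′ t≤u′)
    ... | inj₂ (≡.refl , ≡.refl , t∸s≡0) | _ =
      annihilate (trans (*-congʳ (trans (reflexive (≡.cong (ω₁ zero true false) t∸s≡0)) (vanish₁ zero))) (zeroˡ _))
    ... | _ | inj₂ (≡.refl , ≡.refl , u∸t≡0) =
      annihilate (trans (*-congˡ (trans (reflexive (≡.cong (ω₂ zero true false) u∸t≡0)) (vanish₂ zero))) (zeroʳ _))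
    branch : ∀ y → sumV m (λ ys → W₁ y ys * W₂ y ys) ≈ coefficient y * rest
    branch y = begin
      sumV m (λ ys → W₁ y ys * W₂ y ys)
        ≈⟨ sumV-cong m (λ ys → reflexive (≡.cong₂ _*_ (prefixWeight-∷ ω₁ x xs y ys s≤t) (prefixWeight-∷ ω₂ y ys z zs t≤u))) ⟩
      sumV m (λ ys → (ω₁ zero x y (t ∸ s) * W₁′ y ys) * (ω₂ zero y z (u ∸ t) * W₂′ y ys))
        ≈⟨ sumV-cong m (λ ys → interchange _ _ _ _) ⟩
      sumV m (λ ys → coefficient y * (W₁′ y ys * W₂′ y ys))
        ≈⟨ sumV-*ˡ m _ _ ⟩
      coefficient y * sumV m (λ ys → W₁′ y ys * W₂′ y ys)
        ≈⟨ inner y ⟩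
      coefficient y * rest ∎

  prefixWeight-diagonal : ∀ {m} (ω : LocalWeight m) → (∀ j x → ω j x x 0 ≈ 1#) → ∀ s xs → prefixWeight ω s xs s xs ≈ 1#
  prefixWeight-diagonal ω diagonal s []       = reflexive (prefixWeight-[] ω (ℕ.≤-refl {s}))
  prefixWeight-diagonal ω diagonal s (x ∷ xs) = begin
    prefixWeight ω s (x ∷ xs) s (x ∷ xs) ≡⟨ prefixWeight-∷ ω x xs x xs (ℕ.≤-refl {s}) ⟩
    ω zero x x (s ∸ s) * rest            ≡⟨ ≡.cong (λ d → ω zero x x d * rest) (ℕ.n∸n≡0 s) ⟩
    ω zero x x 0 * rest                  ≈⟨ *-cong (diagonal zero x) (prefixWeight-diagonal (ω ∘ suc) (diagonal ∘ suc) _ xs) ⟩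
    1# * 1#                              ≈⟨ *-identityʳ 1# ⟩
    1#                                   ∎
    where rest = prefixWeight (ω ∘ suc) (s ℕ.+ b2n x) xs (s ℕ.+ b2n x) xs

  prefixWeight-offdiagonal : ∀ {m} (ω : LocalWeight m) → (∀ j x z → x ≢ z → ω j x z 0 ≈ 0#) →
                             ∀ s xs zs → xs ≢ zs → prefixWeight ω s xs s zs ≈ 0#
  prefixWeight-offdiagonal ω offdiagonal s []       []       xs≢zs = contradiction ≡.refl xs≢zs
  prefixWeight-offdiagonal ω offdiagonal s (x ∷ xs) (z ∷ zs) xs≢zs
    rewrite prefixWeight-∷ ω x xs z zs (ℕ.≤-refl {s}) | ℕ.n∸n≡0 s with x Bool.≟ z
  ... | yes ≡.refl = trans (*-congˡ (prefixWeight-offdiagonal (ω ∘ suc) (offdiagonal ∘ suc) _ xs zs (xs≢zs ∘ ≡.cong (x ∷_)))) (zeroʳ _)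
  ... | no x≢z     = trans (*-congʳ (offdiagonal zero x z x≢z)) (zeroˡ _)

  -- ζ and μ are the local weights of z and m at one position, η that of their product (ζμ-compose).
  ζ : Carrier → Bool → Bool → ℕ → Carrier
  ζ u true false d = 1# - pow u d
  ζ u _    _     d = 1#

  sgnb : Bool → Carrier
  sgnb x = pow (- 1#) (b2n x)

  μ : Carrier → Carrier → Bool → Bool → ℕ → Carrier
  μ u u⁻¹ y z d = ζ u⁻¹ y z d * (sgnb y * sgnb z) * pow u d

  η : Carrier → Bool → Bool → ℕ → Carrier
  η u false false d = 1#
  η u false true  d = 0#
  η u true  true  d = pow u d
  η u true  false d = 1# - pow u d

  ζ-vanishes : ∀ u → ζ u true false 0 ≈ 0#
  ζ-vanishes u = -‿inverseʳ 1#

  μ-vanishes : ∀ u u⁻¹ → μ u u⁻¹ true false 0 ≈ 0#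
  μ-vanishes u u⁻¹ = trans (*-congʳ (trans (*-congʳ (ζ-vanishes u⁻¹)) (zeroˡ _))) (zeroˡ _)

  η-diagonal : ∀ u x → η u x x 0 ≈ 1#
  η-diagonal u false = refl
  η-diagonal u true  = refl

  η-offdiagonal : ∀ u x z → x ≢ z → η u x z 0 ≈ 0#
  η-offdiagonal u false false x≢z = contradiction ≡.refl x≢z
  η-offdiagonal u false true  _   = refl
  η-offdiagonal u true  true  x≢z = contradiction ≡.refl x≢z
  η-offdiagonal u true  false _   = -‿inverseʳ 1#

  -- sgnbₚ x evaluates to sgnb x, so the polynomials below are the weights unfolded.
  private
    sgnbₚ : ∀ {k} → Bool → Polynomial k
    sgnbₚ true  = :- 𝟙 :* 𝟙
    sgnbₚ false = 𝟙

  ζμ-compose : ∀ {u u⁻¹} → u * u⁻¹ ≈ 1# → ∀ x z d e →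
               ζ u x true d * μ u u⁻¹ true z e + ζ u x false d * μ u u⁻¹ false z e ≈ η u x z (d ℕ.+ e)
  ζμ-compose {u} {u⁻¹} inv false false d e = trans
    (solve 2 (λ A B → 𝟙 :* ((𝟙 :- B) :* (sgnbₚ true :* sgnbₚ false) :* A) :+ 𝟙 :* (𝟙 :* (sgnbₚ false :* sgnbₚ false) :* A)
                      := A :* B)
             refl (pow u e) (pow u⁻¹ e))
    (pow-inverse inv e)
  ζμ-compose {u} {u⁻¹} inv false true d e =
    solve 1 (λ A → 𝟙 :* (𝟙 :* (sgnbₚ true :* sgnbₚ true) :* A) :+ 𝟙 :* (𝟙 :* (sgnbₚ false :* sgnbₚ true) :* A)
                   := 𝟘)
            refl (pow u e)
  ζμ-compose {u} {u⁻¹} inv true true d e = trans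
    (solve 2 (λ A D → 𝟙 :* (𝟙 :* (sgnbₚ true :* sgnbₚ true) :* A) :+ (𝟙 :- D) :* (𝟙 :* (sgnbₚ false :* sgnbₚ true) :* A)
                      := D :* A)
             refl (pow u e) (pow u d))
    (sym (pow-+ u d e))
  ζμ-compose {u} {u⁻¹} inv true false d e = trans
    (solve 3 (λ A B D → 𝟙 :* ((𝟙 :- B) :* (sgnbₚ true :* sgnbₚ false) :* A) :+ (𝟙 :- D) :* (𝟙 :* (sgnbₚ false :* sgnbₚ false) :* A)
                        := A :* B :- D :* A)
             refl (pow u e) (pow u⁻¹ e) (pow u d))
    (+-cong (pow-inverse inv e) (-‿cong (sym (pow-+ u d e))))

  module _ {m : ℕ} (Ys Y⁻¹s : Fin m → Carrier) (inv : ∀ j → Ys j * Y⁻¹s j ≈ 1#) where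

    ζμ-∑ : ∀ {s t u} xs zs → s ≤ t → t ≤ u →
           sumV m (λ ys → prefixWeight (λ j → ζ (Ys j)) s xs t ys * prefixWeight (λ j → μ (Ys j) (Y⁻¹s j)) t ys u zs)
           ≈ prefixWeight (λ j → η (Ys j)) s xs u zs
    ζμ-∑ = prefixWeight-∑ _ _ _ (λ j → ζμ-compose (inv j)) (λ j → ζ-vanishes (Ys j)) (λ j → μ-vanishes (Ys j) (Y⁻¹s j))

  prefixProduct : ∀ {m} → LocalWeight m → ℕ → Vec Bool m → ℕ → Vec Bool m → Carrier
  prefixProduct ω s xs t ys = prodF (λ j → ω j (lookup xs j) (lookup ys j) ((t ℕ.+ bitsum (toℕ j) ys) ∸ (s ℕ.+ bitsum (toℕ j) xs)))

  prefixProduct-∷ : ∀ {m} (ω : LocalWeight (suc m)) s x xs t y ys →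
                    prefixProduct ω s (x ∷ xs) t (y ∷ ys) ≈ ω zero x y (t ∸ s) * prefixProduct (ω ∘ suc) (s ℕ.+ b2n x) xs (t ℕ.+ b2n y) ys
  prefixProduct-∷ ω s x xs t y ys = *-cong
    (reflexive (≡.cong₂ (λ t′ s′ → ω zero x y (t′ ∸ s′)) (ℕ.+-identityʳ t) (ℕ.+-identityʳ s)))
    (prodF-cong (λ j → reflexive (≡.cong₂ (λ t′ s′ → ω (suc j) (lookup xs j) (lookup ys j) (t′ ∸ s′))
                                          (≡.sym (ℕ.+-assoc t (b2n y) _)) (≡.sym (ℕ.+-assoc s (b2n x) _)))))

  prefixWeight-unfold : ∀ {m} (ω : LocalWeight m) s xs t ys →
                        (if prefixLeq s xs t ys then prefixProduct ω s xs t ys else 0#) ≈ prefixWeight ω s xs t ys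
  prefixWeight-unfold ω s [] t [] rewrite prefixLeq-[] s t = refl
  prefixWeight-unfold ω s (x ∷ xs) t (y ∷ ys) rewrite prefixLeq-∷ s x xs t y ys with s ≤ᵇ t
  ... | false = refl
  ... | true  = begin
    (if L then prefixProduct ω s (x ∷ xs) t (y ∷ ys) else 0#)                 ≈⟨ if-cong L (prefixProduct-∷ ω s x xs t y ys) ⟩
    (if L then ω zero x y (t ∸ s) * prefixProduct (ω ∘ suc) s′ xs t′ ys else 0#) ≈⟨ if-*ˡ L _ _ ⟩
    ω zero x y (t ∸ s) * (if L then prefixProduct (ω ∘ suc) s′ xs t′ ys else 0#) ≈⟨ *-congˡ (prefixWeight-unfold (ω ∘ suc) s′ xs t′ ys) ⟩
    ω zero x y (t ∸ s) * prefixWeight (ω ∘ suc) s′ xs t′ ys                     ∎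
    where
    s′ = s ℕ.+ b2n x
    t′ = t ℕ.+ b2n y
    L = prefixLeq s′ xs t′ ys

  module _ {n r : ℕ} where

    φfactor-ζ : ∀ (Y : Fin (suc n) → Carrier) (a b : P n r) j →
                φfactor Y a b j ≈ ζ (Y (suc j)) (lookup (proj₂ a) j) (lookup (proj₂ b) j) (pre b (toℕ j) ∸ pre a (toℕ j))
    φfactor-ζ Y a b j with lookup (proj₂ a) j | lookup (proj₂ b) j
    ... | true  | true  = refl
    ... | true  | false = refl
    ... | false | _     = refl

    w-unfold : ∀ (Y : Fin (suc n) → Carrier) (a b : P n r) →
               w Y a b ≈ gbinom (Y zero) (a₀ b) (a₀ a) * prefixWeight (λ j → ζ (Y (suc j))) (a₀ a) (proj₂ a) (a₀ b) (proj₂ b)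
    w-unfold Y a b = *-congˡ (trans (if-cong (leqt a b) (prodF-cong (φfactor-ζ Y a b)))
                                    (prefixWeight-unfold _ (a₀ a) (proj₂ a) (a₀ b) (proj₂ b)))

  bitTwist : ∀ {m} → (Fin m → Carrier) → (Fin m → Carrier) → ℕ → Vec Bool m → ℕ → Vec Bool m → Carrier
  bitTwist {m} Ys Y⁻¹s s xs t ys =
    (pow (- 1#) (bitsum m ys) * pow (- 1#) (bitsum m xs))
    * prodF (λ j → ipow (Ys j) (Y⁻¹s j) (+ (t ℕ.+ bitsum (toℕ j) ys) ℤ.- + (s ℕ.+ bitsum (toℕ j) xs)))

  bitTwist-∷ : ∀ {m} (Ys Y⁻¹s : Fin (suc m) → Carrier) {s t} x xs y ys → s ≤ t →
               bitTwist Ys Y⁻¹s s (x ∷ xs) t (y ∷ ys)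
               ≈ (sgnb y * sgnb x * pow (Ys zero) (t ∸ s)) * bitTwist (Ys ∘ suc) (Y⁻¹s ∘ suc) (s ℕ.+ b2n x) xs (t ℕ.+ b2n y) ys
  bitTwist-∷ {m} Ys Y⁻¹s {s} {t} x xs y ys s≤t = begin
    (pow (- 1#) (b2n y ℕ.+ bitsum m ys) * pow (- 1#) (b2n x ℕ.+ bitsum m xs)) * (I₀ * prodF tail)
      ≈⟨ *-cong (*-cong (pow-+ (- 1#) (b2n y) _) (pow-+ (- 1#) (b2n x) _)) (*-cong first (prodF-cong shift)) ⟩
    (sgnb y * Sy) * (sgnb x * Sx) * (pow (Ys zero) (t ∸ s) * prodF tail′)
      ≈⟨ solve 6 (λ a b c d e f → (a :* b) :* (c :* d) :* (e :* f) := (a :* c :* e) :* ((b :* d) :* f)) refl _ _ _ _ _ _ ⟩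
    (sgnb y * sgnb x * pow (Ys zero) (t ∸ s)) * ((Sy * Sx) * prodF tail′) ∎
    where
    Sy = pow (- 1#) (bitsum m ys)
    Sx = pow (- 1#) (bitsum m xs)
    I₀ = ipow (Ys zero) (Y⁻¹s zero) (+ (t ℕ.+ 0) ℤ.- + (s ℕ.+ 0))
    tail : Fin m → Carrier
    tail j = ipow (Ys (suc j)) (Y⁻¹s (suc j)) (+ (t ℕ.+ (b2n y ℕ.+ bitsum (toℕ j) ys)) ℤ.- + (s ℕ.+ (b2n x ℕ.+ bitsum (toℕ j) xs)))
    tail′ : Fin m → Carrier
    tail′ j = ipow (Ys (suc j)) (Y⁻¹s (suc j)) (+ (t ℕ.+ b2n y ℕ.+ bitsum (toℕ j) ys) ℤ.- + (s ℕ.+ b2n x ℕ.+ bitsum (toℕ j) xs))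
    first : I₀ ≈ pow (Ys zero) (t ∸ s)
    first rewrite ℕ.+-identityʳ t | ℕ.+-identityʳ s = reflexive (ipow-∸ (Ys zero) (Y⁻¹s zero) s≤t)
    shift : ∀ j → tail j ≈ tail′ j
    shift j = reflexive (≡.cong₂ (λ t′ s′ → ipow (Ys (suc j)) (Y⁻¹s (suc j)) (+ t′ ℤ.- + s′))
                                 (≡.sym (ℕ.+-assoc t (b2n y) _)) (≡.sym (ℕ.+-assoc s (b2n x) _)))

  bitTwist-prefixWeight : ∀ {m} (Ys Y⁻¹s : Fin m → Carrier) s xs t ys →
                          bitTwist Ys Y⁻¹s s xs t ys * prefixWeight (λ j → ζ (Y⁻¹s j)) s xs t ys
                          ≈ prefixWeight (λ j → μ (Ys j) (Y⁻¹s j)) s xs t ys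
  bitTwist-prefixWeight Ys Y⁻¹s s [] t [] = trans (*-congʳ (trans (*-identityʳ _) (*-identityʳ 1#))) (*-identityˡ _)
  bitTwist-prefixWeight Ys Y⁻¹s s (x ∷ xs) t (y ∷ ys) with s ℕ.≤? t
  ... | no s≰t rewrite prefixWeight-≰ (λ j → ζ (Y⁻¹s j)) (x ∷ xs) (y ∷ ys) s≰t
                     | prefixWeight-≰ (λ j → μ (Ys j) (Y⁻¹s j)) (x ∷ xs) (y ∷ ys) s≰t = zeroʳ _
  ... | yes s≤t rewrite prefixWeight-∷ (λ j → ζ (Y⁻¹s j)) x xs y ys s≤t
                      | prefixWeight-∷ (λ j → μ (Ys j) (Y⁻¹s j)) x xs y ys s≤t = begin
    bitTwist Ys Y⁻¹s s (x ∷ xs) t (y ∷ ys) * (ζ (Y⁻¹s zero) x y (t ∸ s) * W)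
      ≈⟨ *-congʳ (bitTwist-∷ Ys Y⁻¹s x xs y ys s≤t) ⟩
    (sgnb y * sgnb x * pow (Ys zero) (t ∸ s)) * T * (ζ (Y⁻¹s zero) x y (t ∸ s) * W)
      ≈⟨ solve 6 (λ a b c t z w → (a :* b :* c) :* t :* (z :* w) := (z :* (b :* a) :* c) :* (t :* w)) refl _ _ _ _ _ _ ⟩
    μ (Ys zero) (Y⁻¹s zero) x y (t ∸ s) * (T * W)
      ≈⟨ *-congˡ (bitTwist-prefixWeight (Ys ∘ suc) (Y⁻¹s ∘ suc) _ xs _ ys) ⟩
    μ (Ys zero) (Y⁻¹s zero) x y (t ∸ s) * prefixWeight (λ j → μ (Ys (suc j)) (Y⁻¹s (suc j))) (s ℕ.+ b2n x) xs (t ℕ.+ b2n y) ys ∎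
    where
    T = bitTwist (Ys ∘ suc) (Y⁻¹s ∘ suc) (s ℕ.+ b2n x) xs (t ℕ.+ b2n y) ys
    W = prefixWeight (λ j → ζ (Y⁻¹s (suc j))) (s ℕ.+ b2n x) xs (t ℕ.+ b2n y) ys

  -- The twist and the inverse

  module _ {n r : ℕ} where

    a₀≤r : ∀ (a : P n r) → a₀ a ≤ r
    a₀≤r a = ℕ.≤-pred (Fin.toℕ<n (proj₁ a))

    -- Mm Y Y⁻¹ a b is twist Y Y⁻¹ a b * w Y⁻¹ a b by definition.
    twist : (Y Y⁻¹ : Fin (suc n) → Carrier) → P n r → P n r → Carrier
    twist Y Y⁻¹ a b = sgn (Δ (Fin.fromℕ (suc n)) a b) * prodF (λ i → ipow (Y i) (Y⁻¹ i) (Δ (Fin.inject₁ i) a b))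

    module _ (Y Y⁻¹ : Fin (suc n) → Carrier) where

      twist-unfold : ∀ b c → twist Y Y⁻¹ b c
                     ≈ ((pow (- 1#) (a₀ c) * pow (- 1#) (a₀ b)) * ipow (Y zero) (Y⁻¹ zero) (Δ zero b c))
                       * bitTwist (Y ∘ suc) (Y⁻¹ ∘ suc) (a₀ b) (proj₂ b) (a₀ c) (proj₂ c)
      twist-unfold b c = begin
        sgn (Δ (Fin.fromℕ (suc n)) b c) * (I₀ * prodF rest)
          ≈⟨ *-cong sign (*-congˡ (prodF-cong (λ j → reflexive (≡.cong (exponent j) (Fin.toℕ-inject₁ j))))) ⟩
        ((pow (- 1#) (a₀ c) * Sc) * (pow (- 1#) (a₀ b) * Sb)) * (I₀ * prodF (λ j → exponent j (toℕ j)))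
          ≈⟨ solve 6 (λ mc sc mb sb i p → ((mc :* sc) :* (mb :* sb)) :* (i :* p) := ((mc :* mb) :* i) :* ((sc :* sb) :* p)) refl _ _ _ _ _ _ ⟩
        ((pow (- 1#) (a₀ c) * pow (- 1#) (a₀ b)) * I₀) * ((Sc * Sb) * prodF (λ j → exponent j (toℕ j))) ∎
        where
        I₀ = ipow (Y zero) (Y⁻¹ zero) (Δ zero b c)
        Sb = pow (- 1#) (bitsum n (proj₂ b))
        Sc = pow (- 1#) (bitsum n (proj₂ c))
        rest : Fin n → Carrier
        rest j = ipow (Y (suc j)) (Y⁻¹ (suc j)) (Δ (Fin.inject₁ (suc j)) b c)
        exponent : Fin n → ℕ → Carrier
        exponent j k = ipow (Y (suc j)) (Y⁻¹ (suc j)) (+ pre c k ℤ.- + pre b k)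
        sign : sgn (Δ (Fin.fromℕ (suc n)) b c) ≈ (pow (- 1#) (a₀ c) * Sc) * (pow (- 1#) (a₀ b) * Sb)
        sign = begin
          sgn (Δ (Fin.fromℕ (suc n)) b c)                 ≡⟨ ≡.cong (λ k → sgn (+ pre c k ℤ.- + pre b k)) (Fin.toℕ-fromℕ n) ⟩
          sgn (+ pre c n ℤ.- + pre b n)                   ≈⟨ sgn-split (pre c n) (pre b n) ⟩
          pow (- 1#) (pre c n) * pow (- 1#) (pre b n)     ≈⟨ *-cong (pow-+ (- 1#) (a₀ c) _) (pow-+ (- 1#) (a₀ b) _) ⟩
          (pow (- 1#) (a₀ c) * Sc) * (pow (- 1#) (a₀ b) * Sb) ∎

      Mm-unfold : ∀ b c → Mm Y Y⁻¹ b c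
                  ≈ θ⁻¹ (Y zero) (Y⁻¹ zero) (a₀ b) (a₀ c) * prefixWeight (λ j → μ (Y (suc j)) (Y⁻¹ (suc j))) (a₀ b) (proj₂ b) (a₀ c) (proj₂ c)
      Mm-unfold b c = begin
        twist Y Y⁻¹ b c * w Y⁻¹ b c                       ≈⟨ *-cong (twist-unfold b c) (w-unfold Y⁻¹ b c) ⟩
        (T₀ * bitTwist (Y ∘ suc) (Y⁻¹ ∘ suc) b₀ bs c₀ cs) * (gbinom (Y⁻¹ zero) c₀ b₀ * W)
                                                           ≈⟨ interchange _ _ _ _ ⟩
        (T₀ * gbinom (Y⁻¹ zero) c₀ b₀) * (bitTwist (Y ∘ suc) (Y⁻¹ ∘ suc) b₀ bs c₀ cs * W)
                                                           ≈⟨ *-congˡ (bitTwist-prefixWeight (Y ∘ suc) (Y⁻¹ ∘ suc) b₀ bs c₀ cs) ⟩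
        θ⁻¹ (Y zero) (Y⁻¹ zero) b₀ c₀ * prefixWeight (λ j → μ (Y (suc j)) (Y⁻¹ (suc j))) b₀ bs c₀ cs ∎
        where
        b₀ = a₀ b
        c₀ = a₀ c
        bs = proj₂ b
        cs = proj₂ c
        T₀ = (pow (- 1#) c₀ * pow (- 1#) b₀) * ipow (Y zero) (Y⁻¹ zero) (Δ zero b c)
        W = prefixWeight (λ j → ζ (Y⁻¹ (suc j))) b₀ bs c₀ cs

      module _ (inv : ∀ i → Y i * Y⁻¹ i ≈ 1#) where

        Z-M-sumP : ∀ a c → sumP (λ b → Zm Y Y⁻¹ a b * Mm Y Y⁻¹ b c)
                   ≈ sumℕ (suc r) (λ b → gbinom (Y zero) b (a₀ a) * θ⁻¹ (Y zero) (Y⁻¹ zero) b (a₀ c))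
                     * prefixWeight (λ j → η (Y (suc j))) (a₀ a) (proj₂ a) (a₀ c) (proj₂ c)
        Z-M-sumP a c = begin
          sumP (λ b → Zm Y Y⁻¹ a b * Mm Y Y⁻¹ b c)
                      ≈⟨ sumP-cong factor ⟩
          sumℕ (suc r) (λ b → sumV n (λ ys → Θ b * bits b ys))
                      ≈⟨ sumℕ-cong (suc r) (λ b _ → trans (sumV-*ˡ n (Θ b) (bits b)) (collapse b)) ⟩
          sumℕ (suc r) (λ b → Θ b * H)
                      ≈⟨ sumℕ-*ʳ (suc r) Θ H ⟩
          sumℕ (suc r) Θ * H ∎
          where
          a₀′ = a₀ a
          c₀ = a₀ c
          Θ : ℕ → Carrier
          Θ b = gbinom (Y zero) b a₀′ * θ⁻¹ (Y zero) (Y⁻¹ zero) b c₀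
          bits : ℕ → Vec Bool n → Carrier
          bits b ys = prefixWeight (λ j → ζ (Y (suc j))) a₀′ (proj₂ a) b ys * prefixWeight (λ j → μ (Y (suc j)) (Y⁻¹ (suc j))) b ys c₀ (proj₂ c)
          H = prefixWeight (λ j → η (Y (suc j))) a₀′ (proj₂ a) c₀ (proj₂ c)
          factor : ∀ b → Zm Y Y⁻¹ a b * Mm Y Y⁻¹ b c ≈ Θ (a₀ b) * bits (a₀ b) (proj₂ b)
          factor b = trans (*-cong (w-unfold Y a b) (Mm-unfold b c)) (interchange _ _ _ _)
          collapse : ∀ b → Θ b * sumV n (bits b) ≈ Θ b * H
          collapse b with a₀′ ℕ.≤? b | b ℕ.≤? c₀
          ... | yes a≤b | yes b≤c = *-congˡ (ζμ-∑ (Y ∘ suc) (Y⁻¹ ∘ suc) (inv ∘ suc) (proj₂ a) (proj₂ c) a≤b b≤c)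
          ... | no a≰b  | _       = annihilate (trans (*-congʳ (gbinom-vanishes (Y zero) (ℕ.≰⇒> a≰b))) (zeroˡ _))
          ... | yes _   | no b≰c  = annihilate (trans (*-congˡ (θ⁻¹-vanishes (inv zero) (ℕ.≰⇒> b≰c))) (zeroʳ _))

        Z-M-factors-δ : ∀ a c → sumℕ (suc r) (λ b → gbinom (Y zero) b (a₀ a) * θ⁻¹ (Y zero) (Y⁻¹ zero) b (a₀ c))
                                * prefixWeight (λ j → η (Y (suc j))) (a₀ a) (proj₂ a) (a₀ c) (proj₂ c)
                                ≈ δ a c
        Z-M-factors-δ a c with a ≟P c
        ... | yes ≡.refl = trans (*-cong (θθ⁻¹-diagonal (inv zero) (a₀ a) (a₀≤r a))
                                        (prefixWeight-diagonal _ (λ j → η-diagonal (Y (suc j))) (a₀ a) (proj₂ a)))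
                                 (*-identityʳ 1#)
        ... | no a≢c with a₀ a ℕ.≟ a₀ c
        ...   | no a₀≢c₀  = trans (*-congʳ (θθ⁻¹-offdiagonal (inv zero) (a₀ a) (a₀ c) (a₀≤r c) a₀≢c₀)) (zeroˡ _)
        ...   | yes a₀≡c₀ = trans (*-congˡ η-weight≈0) (zeroʳ _)
          where
          η-weight≈0 : prefixWeight (λ j → η (Y (suc j))) (a₀ a) (proj₂ a) (a₀ c) (proj₂ c) ≈ 0#
          η-weight≈0 = ≡.subst (λ k → prefixWeight (λ j → η (Y (suc j))) (a₀ a) (proj₂ a) k (proj₂ c) ≈ 0#) a₀≡c₀
                         (prefixWeight-offdiagonal _ (λ j → η-offdiagonal (Y (suc j))) (a₀ a) (proj₂ a) (proj₂ c)
                           (λ as≡cs → a≢c (≡.cong₂ _,_ (Fin.toℕ-injective a₀≡c₀) as≡cs)))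

        Z-M-inverse : ∀ {enum : List (P n r)} → Unique enum → (∀ a → a ∈ enum) →
                      ∀ a c → sumL enum (λ b → Zm Y Y⁻¹ a b * Mm Y Y⁻¹ b c) ≈ δ a c
        Z-M-inverse unique complete a c =
          trans (sumL-enumeration unique complete _) (trans (Z-M-sumP a c) (Z-M-factors-δ a c))

    twist-split : ∀ {Y Y⁻¹} → (∀ i → Y i * Y⁻¹ i ≈ 1#) → ∀ a b c → twist Y Y⁻¹ a b ≈ twist Y Y⁻¹ a c * twist Y⁻¹ Y b c
    twist-split {Y} {Y⁻¹} inv a b c = begin
      sgn (Δ last a b) * prodF (λ i → ipow (Y i) (Y⁻¹ i) (Δ (Fin.inject₁ i) a b))
        ≈⟨ *-cong sign (prodF-cong (λ i → split (inv i) (Fin.inject₁ i))) ⟩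
      (sgn (Δ last a c) * sgn (Δ last b c)) * prodF (λ i → ac i * bc i)
        ≈⟨ *-congˡ (prodF-distrib ac bc) ⟩
      (sgn (Δ last a c) * sgn (Δ last b c)) * (prodF ac * prodF bc)
        ≈⟨ interchange _ _ _ _ ⟩
      twist Y Y⁻¹ a c * twist Y⁻¹ Y b c ∎
      where
      ac bc : Fin (suc n) → Carrier
      ac i = ipow (Y i) (Y⁻¹ i) (Δ (Fin.inject₁ i) a c)
      bc i = ipow (Y⁻¹ i) (Y i) (Δ (Fin.inject₁ i) b c)
      last = Fin.fromℕ (suc n)
      split : ∀ {u u⁻¹} → u * u⁻¹ ≈ 1# → ∀ i → ipow u u⁻¹ (Δ i a b) ≈ ipow u u⁻¹ (Δ i a c) * ipow u⁻¹ u (Δ i b c)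
      split {u} {u⁻¹} u*u⁻¹≈1 i = begin
        ipow u u⁻¹ (Δ i a b)                                  ≡⟨ ≡.cong (ipow u u⁻¹) (Δ-split i a b c) ⟩
        ipow u u⁻¹ (Δ i a c ℤ.+ ℤ.- Δ i b c)                  ≈⟨ ipow-+ u*u⁻¹≈1 (Δ i a c) (ℤ.- Δ i b c) ⟩
        ipow u u⁻¹ (Δ i a c) * ipow u u⁻¹ (ℤ.- Δ i b c)       ≡⟨ ≡.cong (ipow u u⁻¹ (Δ i a c) *_) (ipow-neg u u⁻¹ (Δ i b c)) ⟩
        ipow u u⁻¹ (Δ i a c) * ipow u⁻¹ u (Δ i b c)           ∎
      sign : sgn (Δ last a b) ≈ sgn (Δ last a c) * sgn (Δ last b c)
      sign = begin
        sgn (Δ last a b)                                                    ≡⟨ sgn≡ipow (Δ last a b) ⟩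
        ipow (- 1#) (- 1#) (Δ last a b)                                     ≈⟨ split -1*-1≈1 last ⟩
        ipow (- 1#) (- 1#) (Δ last a c) * ipow (- 1#) (- 1#) (Δ last b c)   ≡⟨ ≡.cong₂ _*_ (sgn≡ipow (Δ last a c)) (sgn≡ipow (Δ last b c)) ⟨
        sgn (Δ last a c) * sgn (Δ last b c)                                 ∎

    twist-refl : ∀ Y Y⁻¹ a → twist Y Y⁻¹ a a ≈ 1#
    twist-refl Y Y⁻¹ a = trans (*-cong (reflexive (≡.cong sgn (Δ-refl (Fin.fromℕ (suc n)) a)))
                                       (prodF-1 _ (λ i → reflexive (≡.cong (ipow (Y i) (Y⁻¹ i)) (Δ-refl (Fin.inject₁ i) a)))))
                               (*-identityˡ 1#)

    M-Z-inverse : ∀ (Y Y⁻¹ : Fin (suc n) → Carrier) → (∀ i → Y i * Y⁻¹ i ≈ 1#) →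
                  ∀ {enum : List (P n r)} → Unique enum → (∀ a → a ∈ enum) →
                  ∀ a c → sumL enum (λ b → Mm Y Y⁻¹ a b * Zm Y Y⁻¹ b c) ≈ δ a c
    M-Z-inverse Y Y⁻¹ inv {enum} unique complete a c = begin
      sumL enum (λ b → Mm Y Y⁻¹ a b * Zm Y Y⁻¹ b c)                           ≈⟨ sumL-cong enum regroup ⟩
      sumL enum (λ b → twist Y Y⁻¹ a c * (Zm Y⁻¹ Y a b * Mm Y⁻¹ Y b c))      ≈⟨ sumL-*ˡ enum _ _ ⟩
      twist Y Y⁻¹ a c * sumL enum (λ b → Zm Y⁻¹ Y a b * Mm Y⁻¹ Y b c)        ≈⟨ *-congˡ (Z-M-inverse Y⁻¹ Y inv′ unique complete a c) ⟩
      twist Y Y⁻¹ a c * δ a c                                                ≈⟨ twist-δ ⟩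
      δ a c                                                                  ∎
      where
      inv′ : ∀ i → Y⁻¹ i * Y i ≈ 1#
      inv′ i = trans (*-comm _ _) (inv i)
      regroup : ∀ b → twist Y Y⁻¹ a b * w Y⁻¹ a b * w Y b c ≈ twist Y Y⁻¹ a c * (w Y⁻¹ a b * (twist Y⁻¹ Y b c * w Y b c))
      regroup b = trans (*-congʳ (*-congʳ (twist-split inv a b c)))
                        (solve 4 (λ t t′ x y → (t :* t′) :* x :* y := t :* (x :* (t′ :* y))) refl _ _ _ _)
      twist-δ : twist Y Y⁻¹ a c * δ a c ≈ δ a c
      twist-δ with a ≟P c
      ... | yes ≡.refl = trans (*-congʳ (twist-refl Y Y⁻¹ a)) (*-identityˡ _)
      ... | no _       = zeroʳ _

lemma5p3 : ∀ {c ℓ : Level} (R : CommutativeRing c ℓ) (n r : ℕ)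
    (Y Yinv : Fin (suc n) → CommutativeRing.Carrier R)
    → (∀ i → CommutativeRing._≈_ R (CommutativeRing._*_ R (Y i) (Yinv i)) (CommutativeRing.1# R))
    → (enum : List (P n r)) → Unique enum → (∀ a → a ∈ enum)
    → (∀ a b → CommutativeRing._≈_ R (Mat._·[_]_ R Y Yinv (Mat.Zm R Y Yinv) enum (Mat.Mm R Y Yinv) a b) (Mat.δ R Y Yinv a b))
    × (∀ a b → CommutativeRing._≈_ R (Mat._·[_]_ R Y Yinv (Mat.Mm R Y Yinv) enum (Mat.Zm R Y Yinv) a b) (Mat.δ R Y Yinv a b))
lemma5p3 R n r Y Yinv inv enum unique complete =
  Z-M-inverse R Y Yinv inv unique complete , M-Z-inverse R Y Yinv inv unique complete
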